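{- Let $p$ be the mesh pattern $(12,R)$ with $R=\{(0,1),(0,2),(1,1),(1,2),(2,0),(2,2)\}$, let $E(t,u)=\sum_{n\ge0}t^n\sum_{\sigma\in K_n}u^{p(\sigma)}$, and let $P(t)=\sum_{n\ge0}|K_n(p)|t^n$. Then $$P(t)=\left(1+t-\frac{tA(t)}{1+t}\right)A(t),\qquad E(t,u)=\left(1+t-ut-\frac{t(1-u)A(t)}{1+t}\right)A(t).$$ The initial terms of $E(t,u)$ are $1+t+2t^4+(12+2u)t^5+(76+14u)t^6+(556+90u)t^7+(4596+646u)t^8+\cdots$.
   Context: A permutation $\sigma=\sigma_1\cdots\sigma_n$ of $\{1,\dots,n\}$ is a king permutation if $|\sigma_{i+1}-\sigma_i|>1$ for all $1\le i\le n-1$. $K_n$ is the set of king permutations of length $n$ ($K_0$ = the empty permutation, $K_1=\{1\}$) and $A(t)=\sum_{n\ge0}|K_n|t^n$ (known to equal $\sum_{n\ge0}n!\,t^n(1-t)^n/(1+t)^n$). For a mesh pattern $p=(12,R)$ with $R\subseteq\{0,1,2\}^2$, an occurrence of $p$ in $\sigma\in S_n$ is a pair of positions $i_1<i_2$ with $\sigma_{i_1}<\sigma_{i_2}$ such that for every $(x,y)\in R$ there is no position $m$ with $i_x<m<i_{x+1}$ and $v_y<\sigma_m<v_{y+1}$, where $i_0=0$, $i_3=n+1$, $v_0=0$, $v_1=\sigma_{i_1}$, $v_2=\sigma_{i_2}$, $v_3=n+1$ (first coordinate of a box indexes positions, second values). $p(\sigma)$ is the number of occurrences of $p$ in $\sigma$;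 $K_n(p)$ is the set of king $n$-permutations with $p(\sigma)=0$. -}

module Defs where

open import Data.Nat using (ℕ; zero; suc; _+_; _∸_; _<ᵇ_; _≡ᵇ_; ∣_-_∣)
open import Data.Bool using (Bool; true; false; _∧_; _∨_; not; if_then_else_)
open import Data.List using (List; []; _∷_; map; concatMap; length; filterᵇ; upTo)
open import Data.Product using (_×_; _,_)
import Data.Integer as ℤ
open ℤ using (ℤ; +_)

-- Permutations of {1,…,n}, as lists σ₁ ⋯ σₙ (one-line notation).

insertAll : ℕ → List ℕ → List (List ℕ)
insertAll x []       = (x ∷ []) ∷ []
insertAll x (y ∷ ys) = (x ∷ y ∷ ys) ∷ map (y ∷_) (insertAll x ys)

perms : ℕ → List (List ℕ)
perms zero    = [] ∷ []
perms (suc n) = concatMap (insertAll (suc n)) (perms n)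

isKing : List ℕ → Bool
isKing []           = true
isKing (x ∷ [])     = true
isKing (x ∷ y ∷ ys) = (1 <ᵇ ∣ x - y ∣) ∧ isKing (y ∷ ys)

K : ℕ → List (List ℕ)
K n = filterᵇ isKing (perms n)

allB : {A : Set} → (A → Bool) → List A → Bool
allB f []       = true
allB f (x ∷ xs) = f x ∧ allB f xs

-- σ_i, 1-indexed (default 0 out of range; never used out of range)
at : List ℕ → ℕ → ℕ
at []       _             = 0
at (x ∷ xs) zero          = 0
at (x ∷ xs) (suc zero)    = x
at (x ∷ xs) (suc (suc i)) = at xs (suc i)

range1 : ℕ → List ℕ
range1 n = map suc (upTo n)

between : ℕ → ℕ → ℕ → Bool
between a m b = (a <ᵇ m) ∧ (m <ᵇ b)

-- the pair of positions i₁ < i₂ (with σ_{i₁} < σ_{i₂}) is an occurrence of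
-- the mesh pattern (12, R) in σ:
-- i₀ = 0, i₃ = n+1, v₀ = 0, v₁ = σ_{i₁}, v₂ = σ_{i₂}, v₃ = n+1; the box (x,y)
-- is empty iff no position m with i_x < m < i_{x+1} and v_y < σ_m < v_{y+1}.
isOcc : List ℕ → List (ℕ × ℕ) → ℕ → ℕ → Bool
isOcc σ R i₁ i₂ =
  (i₁ <ᵇ i₂) ∧ (at σ i₁ <ᵇ at σ i₂) ∧ allB boxEmpty R
  where
  n = length σ
  pos : ℕ → ℕ
  pos 0 = 0
  pos 1 = i₁
  pos 2 = i₂
  pos _ = suc n
  val : ℕ → ℕ
  val 0 = 0
  val 1 = at σ i₁
  val 2 = at σ i₂
  val _ = suc n
  boxEmpty : ℕ × ℕ → Bool
  boxEmpty (x , y) =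
    allB (λ m → not (between (pos x) m (pos (suc x)) ∧
                    between (val y) (at σ m) (val (suc y))))
        (range1 n)

occ12 : List (ℕ × ℕ) → List ℕ → ℕ
occ12 R σ =
  length (filterᵇ (λ ij → isOcc σ R (fst ij) (snd ij))
                  (concatMap (λ i → map (i ,_) (range1 (length σ))) (range1 (length σ))))
  where
  fst : ℕ × ℕ → ℕ
  fst (a , _) = a
  snd : ℕ × ℕ → ℕ
  snd (_ , b) = b

R₃₅ : List (ℕ × ℕ)
R₃₅ = (0 , 1) ∷ (0 , 2) ∷ (1 , 1) ∷ (1 , 2) ∷ (2 , 0) ∷ (2 , 2) ∷ []

p : List ℕ → ℕ
p = occ12 R₃₅

-- Formal power series over ℤ: coefficient sequences.

Series : Set
Series = ℕ → ℤ

-- bivariate series in t, u:  F n k = coefficient of t^n u^k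
BSeries : Set
BSeries = ℕ → ℕ → ℤ

sumTo : ℕ → (ℕ → ℤ) → ℤ
sumTo zero    f = + 0
sumTo (suc n) f = sumTo n f ℤ.+ f n

_⊕_ : Series → Series → Series
(f ⊕ g) n = f n ℤ.+ g n

_⊖_ : Series → Series → Series
(f ⊖ g) n = f n ℤ.- g n

_⊛_ : Series → Series → Series
(f ⊛ g) n = sumTo (suc n) (λ i → f i ℤ.* g (n ∸ i))

one : Series
one zero    = + 1
one (suc _) = + 0

tS : Series
tS 1 = + 1
tS _ = + 0

-- 1/(1+t) = Σ (-1)^n t^n
inv1+t : Series
inv1+t zero    = + 1
inv1+t (suc n) = ℤ.- inv1+t n

_⊕ᵇ_ : BSeries → BSeries → BSeries
(f ⊕ᵇ g) n k = f n k ℤ.+ g n k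

_⊖ᵇ_ : BSeries → BSeries → BSeries
(f ⊖ᵇ g) n k = f n k ℤ.- g n k

_⊛ᵇ_ : BSeries → BSeries → BSeries
(f ⊛ᵇ g) n k = sumTo (suc n) (λ i → sumTo (suc k) (λ j → f i j ℤ.* g (n ∸ i) (k ∸ j)))

lift : Series → BSeries
lift f n zero    = f n
lift f n (suc _) = + 0

uS : BSeries
uS zero 1 = + 1
uS _    _ = + 0

A : Series
A n = + length (K n)

P : Series
P n = + length (filterᵇ (λ σ → p σ ≡ᵇ 0) (K n))

E : BSeries
E n k = + length (filterᵇ (λ σ → p σ ≡ᵇ k) (K n))

P-rhs : Series
P-rhs = ((one ⊕ tS) ⊖ (tS ⊛ (A ⊛ inv1+t))) ⊛ A

E-rhs : BSeries
E-rhs =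
  (((lift one ⊕ᵇ lift tS) ⊖ᵇ (uS ⊛ᵇ lift tS))
     ⊖ᵇ ((lift tS ⊛ᵇ (lift one ⊖ᵇ uS)) ⊛ᵇ lift (A ⊛ inv1+t)))
  ⊛ᵇ lift A

E-init : ℕ → ℕ → ℤ
E-init 0 0 = + 1
E-init 1 0 = + 1
E-init 4 0 = + 2
E-init 5 0 = + 12
E-init 5 1 = + 2
E-init 6 0 = + 76
E-init 6 1 = + 14
E-init 7 0 = + 556
E-init 7 1 = + 90
E-init 8 0 = + 4596
E-init 8 1 = + 646
E-init _ _ = + 0

module Submission where

-- Reading off the six shaded boxes, a pair i < j is an occurrence of p in a permutation σ of [n]
-- exactly when σ_j = n, every other entry left of n lies below σ_i and every entry right of n lies
-- above σ_i. Hence p(σ) ≤ 1, and p(σ) = 1 exactly when σ = α n β with α nonempty and α < β.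
-- Such a σ is a king permutation exactly when α is a king permutation of [m] not ending in n - 1
-- (a real restriction only when β is empty) and β is a shifted king permutation of [k] not
-- starting with k. Deleting a leading (or trailing) maximum shows that the number B_k of king
-- k-permutations not starting (or not ending) with k satisfies B_{k-1} + B_k = A_k, i.e.
-- B = A/(1+t). So the u-coefficient of E is tA(B - 1), the constant coefficient is A minus it,
-- and P is the constant coefficient.

open import Defs
open import Data.Bool using (Bool; true; false; _∧_; not; T)
open import Data.Bool.Properties using (T-∧; ∧-assoc; ∧-identityʳ)
open import Data.Empty using (⊥; ⊥-elim)
open import Data.List
  using (List; []; _∷_; _++_; _∷ʳ_; map; concatMap; length; filterᵇ; upTo; cartesianProduct)
open import Data.List.Extrema.Nat using (max; argmax-sel; xs≤max; max≤v⁺; max<v⁺)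
open import Data.List.Properties
  using (∷-injective; ∷-injectiveˡ; ∷-injectiveʳ; ∷ʳ-injective; ++-assoc; ++-identityʳ; length-map; length-++;
         length-upTo; map-id; map-id-local; map-cong; map-∘; map-++; map-injective; concatMap-++; upTo-∷ʳ;
         filter-all; filter-none)
open import Data.List.Membership.Propositional using (_∈_; _∉_; find; lose)
open import Data.List.Membership.Propositional.Properties
  using (∈-length; ∈-map⁺; ∈-map⁻; ∈-++⁺ˡ; ∈-++⁺ʳ; ∈-++⁻; ∈-∃++; ∈-filter⁺; ∈-filter⁻; ∈-upTo⁺; ∈-upTo⁻;
         ∈-cartesianProduct⁺; ∈-cartesianProduct⁻; ∈-concatMap⁺; ∈-concatMap⁻)
open import Data.List.Membership.Propositional.Properties.WithK using (unique∧set⇒bag)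
open import Data.List.Relation.Binary.BagAndSetEquality using (∼bag⇒↭)
open import Data.List.Relation.Binary.Permutation.Propositional
  using (_↭_; ↭-refl; ↭-sym; ↭-prep; ↭⇒↭ₛ; module PermutationReasoning)
import Data.List.Relation.Binary.Permutation.Propositional.Properties as ↭
import Data.List.Relation.Binary.Permutation.Setoid.Properties as ↭ₛ
open import Data.List.Relation.Binary.Subset.Propositional using (_⊆_)
open import Data.List.Relation.Unary.All using (All; []; _∷_)
import Data.List.Relation.Unary.All as All
import Data.List.Relation.Unary.All.Properties as All
open import Data.List.Relation.Unary.Any using (here; there)
open import Data.List.Relation.Unary.Unique.Propositional using (Unique; []; _∷_)
import Data.List.Relation.Unary.Unique.Propositional.Properties as Unique
open import Data.Nat.Base
  using (ℕ; zero; suc; _+_; _*_; _∸_; ∣_-_∣; _≤_; _<_; z≤n; s≤s; z<s; _≡ᵇ_; _<ᵇ_)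
open import Data.Nat.Properties
open import Data.Product using (∃; ∃₂; _×_; _,_; proj₁; proj₂; uncurry)
open import Data.Sum using (inj₁; inj₂)
open import Function using (id; _∘_; case_of_; mk⇔; Equivalence)
open import Relation.Nullary using (¬_; yes; no)
open import Relation.Binary.Definitions using (tri<; tri≈; tri>)
open import Relation.Nullary.Decidable using (T?)
open import Relation.Binary.PropositionalEquality

module _ {A : Set} where

  unique∧set⇒↭ : ∀ {xs ys : List A} → Unique xs → Unique ys → xs ⊆ ys → ys ⊆ xs → xs ↭ ys
  unique∧set⇒↭ xs! ys! xs⊆ys ys⊆xs = ∼bag⇒↭ (unique∧set⇒bag xs! ys! (mk⇔ xs⊆ys ys⊆xs))

  unique-resp-↭ : ∀ {xs ys : List A} → xs ↭ ys → Unique xs → Unique ys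
  unique-resp-↭ xs↭ys = ↭ₛ.Unique-resp-↭ (setoid A) (↭⇒↭ₛ xs↭ys)

  ++-∷-injective : ∀ {x : A} u u′ {v v′} → x ∉ u → x ∉ u′ → u ++ x ∷ v ≡ u′ ++ x ∷ v′ →
                   u ≡ u′ × v ≡ v′
  ++-∷-injective []      []       _    _     refl = refl , refl
  ++-∷-injective []      (_ ∷ _)  _    x∉u′  refl = ⊥-elim (x∉u′ (here refl))
  ++-∷-injective (_ ∷ _) []       x∉u  _     refl = ⊥-elim (x∉u (here refl))
  ++-∷-injective (y ∷ u) (_ ∷ u′) x∉u  x∉u′  eq
    with refl , eq′ ← ∷-injective eq
    with refl , refl ← ++-∷-injective u u′ (x∉u ∘ there) (x∉u′ ∘ there) eq′ = refl , refl

  ++-uniqueˡ : ∀ (xs : List A) {ys} → Unique (xs ++ ys) → Unique xs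
  ++-uniqueˡ []       _            = []
  ++-uniqueˡ (x ∷ xs) (x∉ ∷ xs!) = All.++⁻ˡ xs x∉ ∷ ++-uniqueˡ xs xs!

  unique∧constant⇒length≤1 : ∀ {xs : List A} → Unique xs → (∀ {x y} → x ∈ xs → y ∈ xs → x ≡ y) →
                             length xs ≤ 1
  unique∧constant⇒length≤1 {[]}         _                  _ = z≤n
  unique∧constant⇒length≤1 {_ ∷ []}     _                  _ = ≤-refl
  unique∧constant⇒length≤1 {_ ∷ _ ∷ _} ((x≢y ∷ _) ∷ _) const =
    ⊥-elim (x≢y (const (here refl) (there (here refl))))

  ++-∷-unique⇒∉ : ∀ (xs : List A) {y ys} → Unique (xs ++ y ∷ ys) → y ∉ xs
  ++-∷-unique⇒∉ (x ∷ xs) (x∉ ∷ _)  (here refl) = All.lookup x∉ (∈-++⁺ʳ xs (here refl)) refl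
  ++-∷-unique⇒∉ (x ∷ xs) (_ ∷ xs!) (there y∈)  = ++-∷-unique⇒∉ xs xs! y∈

  ↭-++-cancelˡ : ∀ (xs : List A) {ys zs} → xs ++ ys ↭ xs ++ zs → ys ↭ zs
  ↭-++-cancelˡ []       ys↭zs = ys↭zs
  ↭-++-cancelˡ (x ∷ xs) ys↭zs = ↭-++-cancelˡ xs (↭.drop-mid [] [] ys↭zs)

  ∈-filterᵇ⁺ : ∀ (f : A → Bool) {x xs} → x ∈ xs → T (f x) → x ∈ filterᵇ f xs
  ∈-filterᵇ⁺ f = ∈-filter⁺ (T? ∘ f)

  ∈-filterᵇ⁻ : ∀ (f : A → Bool) {x xs} → x ∈ filterᵇ f xs → x ∈ xs × T (f x)
  ∈-filterᵇ⁻ f = ∈-filter⁻ (T? ∘ f)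

  filterᵇ-unique : ∀ (f : A → Bool) {xs} → Unique xs → Unique (filterᵇ f xs)
  filterᵇ-unique f = Unique.filter⁺ (T? ∘ f)

  filterᵇ-cong : ∀ {f g : A → Bool} xs → (∀ {x} → x ∈ xs → f x ≡ g x) → filterᵇ f xs ≡ filterᵇ g xs
  filterᵇ-cong             []       _   = refl
  filterᵇ-cong {f} {g} (x ∷ xs) f≡g with f x | g x | f≡g (here refl)
  ... | true  | .true  | refl = cong (x ∷_) (filterᵇ-cong xs (f≡g ∘ there))
  ... | false | .false | refl = filterᵇ-cong xs (f≡g ∘ there)

  length-filterᵇ-not : ∀ (f : A → Bool) xs →
                       length (filterᵇ f xs) + length (filterᵇ (not ∘ f) xs) ≡ length xs
  length-filterᵇ-not f []       = refl
  length-filterᵇ-not f (x ∷ xs) with f x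
  ... | true  = cong suc (length-filterᵇ-not f xs)
  ... | false = trans (+-suc _ _) (cong suc (length-filterᵇ-not f xs))

module _ {A B : Set} where

  InjectiveOn : (A → B) → List A → Set
  InjectiveOn f xs = ∀ {x y} → x ∈ xs → y ∈ xs → f x ≡ f y → x ≡ y

  map-unique : ∀ (f : A → B) {xs} → InjectiveOn f xs → Unique xs → Unique (map f xs)
  map-unique f {[]}     _   []                   = []
  map-unique f {x ∷ xs} inj x∷xs!@(_ ∷ xs!) =
    All.tabulate fx≢ ∷ map-unique f (λ x∈ y∈ → inj (there x∈) (there y∈)) xs!
    where
    fx≢ : ∀ {z} → z ∈ map f xs → f x ≢ z
    fx≢ z∈ fx≡z with y , y∈ , refl ← ∈-map⁻ f z∈ =
      Unique.Unique[x∷xs]⇒x∉xs x∷xs! (subst (_∈ xs) (sym (inj (here refl) (there y∈) fx≡z)) y∈)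

  bijection⇒length≡ : ∀ (f : A → B) {xs ys} → Unique xs → Unique ys → InjectiveOn f xs →
                      (∀ {x} → x ∈ xs → f x ∈ ys) → (∀ {y} → y ∈ ys → ∃ λ x → x ∈ xs × y ≡ f x) →
                      length xs ≡ length ys
  bijection⇒length≡ f {xs} {ys} xs! ys! inj into onto =
    trans (sym (length-map f xs)) (↭.↭-length (unique∧set⇒↭ (map-unique f inj xs!) ys! image⊆ys ys⊆image))
    where
    image⊆ys : map f xs ⊆ ys
    image⊆ys y∈ with x , x∈ , refl ← ∈-map⁻ f y∈ = into x∈
    ys⊆image : ys ⊆ map f xs
    ys⊆image y∈ with x , x∈ , refl ← onto y∈ = ∈-map⁺ f x∈

  concatMap-unique : ∀ (f : A → List B) {xs} → Unique xs → (∀ {x} → x ∈ xs → Unique (f x)) →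
                     (∀ {x y z} → x ∈ xs → y ∈ xs → z ∈ f x → z ∈ f y → x ≡ y) →
                     Unique (concatMap f xs)
  concatMap-unique f {[]}     _                 _  _        = []
  concatMap-unique f {x ∷ xs} x∷xs!@(_ ∷ xs!) f! disjoint =
    Unique.++⁺ (f! (here refl))
               (concatMap-unique f xs! (f! ∘ there) (λ x∈ y∈ → disjoint (there x∈) (there y∈)))
               apart
    where
    apart : ∀ {z} → ¬ (z ∈ f x × z ∈ concatMap f xs)
    apart (z∈fx , z∈rest) with y , y∈ , z∈fy ← find (∈-concatMap⁻ f z∈rest) =
      Unique.Unique[x∷xs]⇒x∉xs x∷xs!
        (subst (_∈ xs) (sym (disjoint (here refl) (there y∈) z∈fx z∈fy)) y∈)

  concatMap-pairs : ∀ (xs : List A) (ys : List B) →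
                    concatMap (λ x → map (x ,_) ys) xs ≡ cartesianProduct xs ys
  concatMap-pairs []       ys = refl
  concatMap-pairs (x ∷ xs) ys = cong (map (x ,_) ys ++_) (concatMap-pairs xs ys)

  length-cartesianProduct : ∀ (xs : List A) (ys : List B) →
                            length (cartesianProduct xs ys) ≡ length xs * length ys
  length-cartesianProduct []       ys = refl
  length-cartesianProduct (x ∷ xs) ys = begin
    length (map (x ,_) ys ++ cartesianProduct xs ys)         ≡⟨ length-++ (map (x ,_) ys) ⟩
    length (map (x ,_) ys) + length (cartesianProduct xs ys)
      ≡⟨ cong₂ _+_ (length-map (x ,_) ys) (length-cartesianProduct xs ys) ⟩
    length ys + length xs * length ys                        ∎
    where open ≡-Reasoning

T-not⇒¬T : ∀ {b} → T (not b) → ¬ T b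
T-not⇒¬T {false} _ ()

¬T⇒T-not : ∀ {b} → ¬ T b → T (not b)
¬T⇒T-not {true}  ¬t = ¬t _
¬T⇒T-not {false} _  = _

∧-split : ∀ a {b} → T (a ∧ b) → T a × T b
∧-split a = Equivalence.to (T-∧ {a})

∧-intro : ∀ a {b} → T a → T b → T (a ∧ b)
∧-intro a ta tb = Equivalence.from (T-∧ {a}) (ta , tb)

T-allB⁻ : ∀ {A : Set} (f : A → Bool) {xs x} → T (allB f xs) → x ∈ xs → T (f x)
T-allB⁻ f {y ∷ _} t (here refl) = proj₁ (∧-split (f y) t)
T-allB⁻ f {y ∷ _} t (there x∈)  = T-allB⁻ f (proj₂ (∧-split (f y) t)) x∈

T-allB⁺ : ∀ {A : Set} (f : A → Bool) xs → (∀ {x} → x ∈ xs → T (f x)) → T (allB f xs)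
T-allB⁺ f []       _  = _
T-allB⁺ f (x ∷ xs) tf = ∧-intro (f x) (tf (here refl)) (T-allB⁺ f xs (tf ∘ there))

max-∈ : ∀ {x xs} → x ∈ xs → 0 < x → max 0 xs ∈ xs
max-∈ {x} {xs} x∈ 0<x with argmax-sel id 0 xs
... | inj₁ max≡0 = ⊥-elim (<⇒≱ 0<x (subst (x ≤_) max≡0 (All.lookup (xs≤max 0 xs) x∈)))
... | inj₂ max∈  = max∈

-- Permutations of [n]

∈-range1⁺ : ∀ {n x} → 0 < x → x ≤ n → x ∈ range1 n
∈-range1⁺ {x = suc x} _ x<n = ∈-map⁺ suc (∈-upTo⁺ x<n)

∈-range1⁻ : ∀ {n x} → x ∈ range1 n → 0 < x × x ≤ n
∈-range1⁻ x∈ with _ , y∈ , refl ← ∈-map⁻ suc x∈ = s≤s z≤n , ∈-upTo⁻ y∈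

range1-unique : ∀ n → Unique (range1 n)
range1-unique n = Unique.map⁺ suc-injective (Unique.upTo⁺ n)

length-range1 : ∀ n → length (range1 n) ≡ n
length-range1 n = trans (length-map suc (upTo n)) (length-upTo n)

range1-∷ʳ : ∀ n → range1 (suc n) ≡ range1 n ∷ʳ suc n
range1-∷ʳ n = trans (cong (map suc) (sym (upTo-∷ʳ n))) (map-++ suc (upTo n) (n ∷ []))

range1-+ : ∀ m k → range1 m ++ map (m +_) (range1 k) ≡ range1 (m + k)
range1-+ m zero    = trans (++-identityʳ (range1 m)) (cong range1 (sym (+-identityʳ m)))
range1-+ m (suc k) = begin
  range1 m ++ map (m +_) (range1 (suc k))              ≡⟨ cong (λ r → range1 m ++ map (m +_) r) (range1-∷ʳ k) ⟩
  range1 m ++ map (m +_) (range1 k ∷ʳ suc k)           ≡⟨ cong (range1 m ++_) (map-++ (m +_) (range1 k) _) ⟩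
  range1 m ++ (map (m +_) (range1 k) ∷ʳ (m + suc k))   ≡⟨ ++-assoc (range1 m) _ _ ⟨
  (range1 m ++ map (m +_) (range1 k)) ∷ʳ (m + suc k)   ≡⟨ cong₂ _∷ʳ_ (range1-+ m k) (+-suc m k) ⟩
  range1 (m + k) ∷ʳ suc (m + k)                        ≡⟨ range1-∷ʳ (m + k) ⟨
  range1 (suc (m + k))                                 ≡⟨ cong range1 (+-suc m k) ⟨
  range1 (m + suc k)                                   ∎
  where open ≡-Reasoning

∈-insertAll⁺ : ∀ (x : ℕ) u v → u ++ x ∷ v ∈ insertAll x (u ++ v)
∈-insertAll⁺ x []      []      = here refl
∈-insertAll⁺ x []      (y ∷ v) = here refl
∈-insertAll⁺ x (y ∷ u) v       = there (∈-map⁺ (y ∷_) (∈-insertAll⁺ x u v))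

∈-insertAll⁻ : ∀ (x : ℕ) τ {σ} → σ ∈ insertAll x τ → ∃₂ λ u v → σ ≡ u ++ x ∷ v × τ ≡ u ++ v
∈-insertAll⁻ x []      (here refl) = [] , [] , refl , refl
∈-insertAll⁻ x (y ∷ τ) (here refl) = [] , y ∷ τ , refl , refl
∈-insertAll⁻ x (y ∷ τ) (there σ∈)
  with _ , ρ∈ , refl ← ∈-map⁻ (y ∷_) σ∈
  with u , v , refl , refl ← ∈-insertAll⁻ x τ ρ∈ = y ∷ u , v , refl , refl

insertAll-unique : ∀ {x : ℕ} τ → x ∉ τ → Unique (insertAll x τ)
insertAll-unique []      _   = [] ∷ []
insertAll-unique {x} (y ∷ τ) x∉ =
  All.tabulate head-fresh ∷ Unique.map⁺ (λ { refl → refl }) (insertAll-unique τ (x∉ ∘ there))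
  where
  head-fresh : ∀ {σ} → σ ∈ map (y ∷_) (insertAll x τ) → x ∷ y ∷ τ ≢ σ
  head-fresh σ∈ refl with _ , _ , x≡y ← ∈-map⁻ (y ∷_) σ∈ = x∉ (here (∷-injectiveˡ x≡y))

insertAll-disjoint : ∀ {x : ℕ} {τ τ′ σ} → x ∉ τ → x ∉ τ′ →
                     σ ∈ insertAll x τ → σ ∈ insertAll x τ′ → τ ≡ τ′
insertAll-disjoint {x} {τ} {τ′} x∉τ x∉τ′ σ∈ σ∈′
  with u , v , refl , refl ← ∈-insertAll⁻ x τ σ∈
  with u′ , v′ , eq , refl ← ∈-insertAll⁻ x τ′ σ∈′
  with refl , refl ← ++-∷-injective u u′ (x∉τ ∘ ∈-++⁺ˡ) (x∉τ′ ∘ ∈-++⁺ˡ) eq = refl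

∈-perms-suc⁺ : ∀ {n} u v → u ++ v ∈ perms n → u ++ suc n ∷ v ∈ perms (suc n)
∈-perms-suc⁺ {n} u v τ∈ = ∈-concatMap⁺ (insertAll (suc n)) (lose τ∈ (∈-insertAll⁺ (suc n) u v))

∈-perms-suc⁻ : ∀ {n σ} → σ ∈ perms (suc n) → ∃₂ λ u v → σ ≡ u ++ suc n ∷ v × u ++ v ∈ perms n
∈-perms-suc⁻ {n} σ∈
  with τ , τ∈ , σ∈τ ← find (∈-concatMap⁻ (insertAll (suc n)) σ∈)
  with u , v , refl , refl ← ∈-insertAll⁻ (suc n) τ σ∈τ = u , v , refl , τ∈

perms-sound : ∀ {n σ} → σ ∈ perms n → σ ↭ range1 n
perms-sound {zero}  (here refl) = ↭-refl
perms-sound {suc n} σ∈ with u , v , refl , τ∈ ← ∈-perms-suc⁻ {n} σ∈ = begin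
  u ++ suc n ∷ v     ↭⟨ ↭.shift (suc n) u v ⟩
  suc n ∷ u ++ v     ↭⟨ ↭-prep (suc n) (perms-sound τ∈) ⟩
  suc n ∷ range1 n   ↭⟨ ↭.∷↭∷ʳ (suc n) (range1 n) ⟩
  range1 n ∷ʳ suc n  ≡⟨ range1-∷ʳ n ⟨
  range1 (suc n)     ∎
  where open PermutationReasoning

perms-complete : ∀ {n σ} → σ ↭ range1 n → σ ∈ perms n
perms-complete {zero}  {[]}    _ = here refl
perms-complete {zero}  {x ∷ σ} σ↭ with () ← ↭.∈-resp-↭ σ↭ (here refl)
perms-complete {suc n} {σ}     σ↭
  with u , v , refl ← ∈-∃++ (↭.∈-resp-↭ (↭-sym σ↭) (∈-range1⁺ {suc n} (s≤s z≤n) ≤-refl)) =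
  ∈-perms-suc⁺ u v (perms-complete (subst (u ++ v ↭_) (++-identityʳ (range1 n)) drop-max))
  where
  drop-max : u ++ v ↭ range1 n ++ []
  drop-max = ↭.drop-mid u (range1 n) (subst (u ++ suc n ∷ v ↭_) (range1-∷ʳ n) σ↭)

module _ {n σ} (σ↭ : σ ↭ range1 n) where

  ↭range1⇒unique : Unique σ
  ↭range1⇒unique = unique-resp-↭ (↭-sym σ↭) (range1-unique n)

  ↭range1⇒bounded : ∀ {x} → x ∈ σ → 0 < x × x ≤ n
  ↭range1⇒bounded x∈ = ∈-range1⁻ (↭.∈-resp-↭ σ↭ x∈)

  ↭range1⇒onto : ∀ {x} → 0 < x → x ≤ n → x ∈ σ
  ↭range1⇒onto 0<x x≤n = ↭.∈-resp-↭ (↭-sym σ↭) (∈-range1⁺ 0<x x≤n)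

  ↭range1⇒length : length σ ≡ n
  ↭range1⇒length = trans (↭.↭-length σ↭) (length-range1 n)

∈-perms⇒≤ : ∀ {n σ x} → σ ∈ perms n → x ∈ σ → x ≤ n
∈-perms⇒≤ σ∈ x∈ = proj₂ (↭range1⇒bounded (perms-sound σ∈) x∈)

∈-perms⇒All≤ : ∀ {n σ} → σ ∈ perms n → All (_≤ n) σ
∈-perms⇒All≤ σ∈ = All.tabulate (∈-perms⇒≤ σ∈)

∈-perms⇒length : ∀ {n σ} → σ ∈ perms n → length σ ≡ n
∈-perms⇒length {n} σ∈ = ↭range1⇒length (perms-sound {n} σ∈)

∈-perms⇒↭range1-length : ∀ {n σ} → σ ∈ perms n → σ ↭ range1 (length σ)
∈-perms⇒↭range1-length {n} {σ} σ∈ = subst (λ l → σ ↭ range1 l) (sym (∈-perms⇒length {n} σ∈)) (perms-sound σ∈)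

perms-unique : ∀ n → Unique (perms n)
perms-unique zero    = [] ∷ []
perms-unique (suc n) =
  concatMap-unique (insertAll (suc n)) (perms-unique n)
    (λ τ∈ → insertAll-unique _ (max∉ τ∈))
    (λ τ∈ τ′∈ → insertAll-disjoint (max∉ τ∈) (max∉ τ′∈))
  where
  max∉ : ∀ {τ} → τ ∈ perms n → suc n ∉ τ
  max∉ τ∈ sn∈ = 1+n≰n (∈-perms⇒≤ τ∈ sn∈)

∈-perms-++⁺ : ∀ {m k α β} → α ∈ perms m → β ∈ perms k → α ++ map (m +_) β ∈ perms (m + k)
∈-perms-++⁺ {m} {k} {α} {β} α∈ β∈ = perms-complete (begin
  α ++ map (m +_) β                   ↭⟨ ↭.++⁺ (perms-sound {m} α∈) (↭.map⁺ (m +_) (perms-sound {k} β∈)) ⟩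
  range1 m ++ map (m +_) (range1 k)   ≡⟨ range1-+ m k ⟩
  range1 (m + k)                      ∎)
  where open PermutationReasoning

↭range1-prefix : ∀ {n α γ} → α ++ γ ↭ range1 n → (∀ {x y} → x ∈ α → y ∈ γ → x < y) →
                 α ↭ range1 (length α)
↭range1-prefix {n} {α} {γ} σ↭ α<γ =
  subst (λ r → α ↭ range1 r) (sym (trans (↭.↭-length α↭M) (length-range1 M))) α↭M
  where
  M = max 0 α

  α-bounded : ∀ {x} → x ∈ α → 0 < x × x ≤ n
  α-bounded x∈ = ↭range1⇒bounded σ↭ (∈-++⁺ˡ x∈)

  α⊆ : α ⊆ range1 M
  α⊆ x∈ = ∈-range1⁺ (proj₁ (α-bounded x∈)) (All.lookup (xs≤max 0 α) x∈)

  ⊆α : range1 M ⊆ α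
  ⊆α z∈ with 0<z , z≤M ← ∈-range1⁻ z∈
        with ∈-++⁻ α (↭range1⇒onto σ↭ 0<z (≤-trans z≤M (max≤v⁺ z≤n (All.tabulate (proj₂ ∘ α-bounded)))))
  ... | inj₁ z∈α = z∈α
  ... | inj₂ z∈γ = ⊥-elim (<⇒≱ (max<v⁺ 0<z (All.tabulate (λ x∈ → α<γ x∈ z∈γ))) z≤M)

  α↭M : α ↭ range1 M
  α↭M = unique∧set⇒↭ (++-uniqueˡ α (↭range1⇒unique σ↭)) (range1-unique M) α⊆ ⊆α

↭range1-suffix : ∀ {n α γ} → α ++ γ ↭ range1 n → α ↭ range1 (length α) →
                 γ ↭ map (length α +_) (range1 (length γ))
↭range1-suffix {n} {α} {γ} σ↭ α↭ = ↭-++-cancelˡ α (begin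
  α ++ γ                              ↭⟨ σ↭ ⟩
  range1 n                            ≡⟨ cong range1 (trans (sym (↭range1⇒length σ↭)) (length-++ α)) ⟩
  range1 (m + k)                      ≡⟨ range1-+ m k ⟨
  range1 m ++ map (m +_) (range1 k)   ↭⟨ ↭.++⁺ʳ _ (↭-sym α↭) ⟩
  α ++ map (m +_) (range1 k)          ∎)
  where
  open PermutationReasoning
  m = length α
  k = length γ

↭-map-+⁻ : ∀ {m k γ} → γ ↭ map (m +_) (range1 k) → ∃ λ β → γ ≡ map (m +_) β × β ↭ range1 k
↭-map-+⁻ {m} {k} {γ} γ↭ = map (_∸ m) γ , γ≡ , β↭
  where
  γ≡ : γ ≡ map (m +_) (map (_∸ m) γ)
  γ≡ = sym (trans (sym (map-∘ γ)) (map-id-local (All.tabulate m+[y∸m]≡y)))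
    where
    m+[y∸m]≡y : ∀ {y} → y ∈ γ → m + (y ∸ m) ≡ y
    m+[y∸m]≡y y∈ with b , _ , refl ← ∈-map⁻ (m +_) (↭.∈-resp-↭ γ↭ y∈) = cong (m +_) (m+n∸m≡n m b)

  β↭ : map (_∸ m) γ ↭ range1 k
  β↭ = begin
    map (_∸ m) γ                        ↭⟨ ↭.map⁺ (_∸ m) γ↭ ⟩
    map (_∸ m) (map (m +_) (range1 k))  ≡⟨ map-∘ (range1 k) ⟨
    map ((_∸ m) ∘ (m +_)) (range1 k)    ≡⟨ map-cong (m+n∸m≡n m) (range1 k) ⟩
    map id (range1 k)                   ≡⟨ map-id (range1 k) ⟩
    range1 k                            ∎
    where open PermutationReasoning

∈-perms-++⁻ : ∀ {n α γ} → α ++ γ ∈ perms n → (∀ {x y} → x ∈ α → y ∈ γ → x < y) →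
              α ∈ perms (length α) × ∃ λ β → γ ≡ map (length α +_) β × β ∈ perms (length γ)
∈-perms-++⁻ {n} σ∈ α<γ with α↭ ← ↭range1-prefix (perms-sound {n} σ∈) α<γ
                      with β , γ≡ , β↭ ← ↭-map-+⁻ (↭range1-suffix (perms-sound {n} σ∈) α↭) =
  perms-complete α↭ , β , γ≡ , perms-complete β↭

at-∈ : ∀ xs {i} → i < length xs → at xs (suc i) ∈ xs
at-∈ (x ∷ xs) {zero}  _         = here refl
at-∈ (x ∷ xs) {suc i} (s≤s i<) = there (at-∈ xs i<)

∈⇒at : ∀ {x xs} → x ∈ xs → ∃ λ i → i < length xs × at xs (suc i) ≡ x
∈⇒at (here refl) = zero , s≤s z≤n , refl
∈⇒at (there x∈) with i , i< , eq ← ∈⇒at x∈ = suc i , s≤s i< , eq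

at-injective : ∀ {xs} → Unique xs → ∀ {i j} → i < length xs → j < length xs →
               at xs (suc i) ≡ at xs (suc j) → i ≡ j
at-injective {x ∷ xs} _            {zero}  {zero}  _        _        _  = refl
at-injective {x ∷ xs} (x∉ ∷ _)     {zero}  {suc j} _        (s≤s j<) eq =
  ⊥-elim (All.lookup x∉ (at-∈ xs j<) eq)
at-injective {x ∷ xs} (x∉ ∷ _)     {suc i} {zero}  (s≤s i<) _        eq =
  ⊥-elim (All.lookup x∉ (at-∈ xs i<) (sym eq))
at-injective {x ∷ xs} (_ ∷ xs!)    {suc i} {suc j} (s≤s i<) (s≤s j<) eq =
  cong suc (at-injective xs! i< j< eq)

at-++ˡ : ∀ xs ys {i} → i < length xs → at (xs ++ ys) (suc i) ≡ at xs (suc i)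
at-++ˡ (x ∷ xs) ys {zero}  _        = refl
at-++ˡ (x ∷ xs) ys {suc i} (s≤s i<) = at-++ˡ xs ys i<

at-++ʳ : ∀ xs ys i → at (xs ++ ys) (suc (length xs + i)) ≡ at ys (suc i)
at-++ʳ []           ys i = refl
at-++ʳ (x ∷ [])     ys i = refl
at-++ʳ (x ∷ y ∷ xs) ys i = at-++ʳ (y ∷ xs) ys i

split-at : ∀ xs {i} → i < length xs → ∃₂ λ α β → xs ≡ α ++ at xs (suc i) ∷ β × length α ≡ i
split-at (x ∷ xs) {zero}  _         = [] , xs , refl , refl
split-at (x ∷ xs) {suc i} (s≤s i<) with α , β , xs≡ , refl ← split-at xs i< =
  x ∷ α , β , cong (x ∷_) xs≡ , refl

module _ {σ} (σ↭ : σ ↭ range1 (length σ)) where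

  perm-at-bounded : ∀ {q} → 0 < q → q ≤ length σ → 0 < at σ q × at σ q ≤ length σ
  perm-at-bounded {suc q} _ q≤ = ↭range1⇒bounded σ↭ (at-∈ σ q≤)

  perm-at-injective : ∀ {q q′} → 0 < q → q ≤ length σ → 0 < q′ → q′ ≤ length σ →
                      at σ q ≡ at σ q′ → q ≡ q′
  perm-at-injective {suc q} {suc q′} _ q≤ _ q′≤ eq =
    cong suc (at-injective (↭range1⇒unique σ↭) q≤ q′≤ eq)

  perm-at-surjective : ∀ {x} → 0 < x → x ≤ length σ → ∃ λ q → 0 < q × q ≤ length σ × at σ q ≡ x
  perm-at-surjective 0<x x≤ with i , i< , eq ← ∈⇒at (↭range1⇒onto σ↭ 0<x x≤) =
    suc i , s≤s z≤n , i< , eq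

-- Occurrences of p

InBox : List ℕ → (lo hi vlo vhi m : ℕ) → Set
InBox σ lo hi vlo vhi m = lo < m × m < hi × vlo < at σ m × at σ m < vhi

EmptyBox : List ℕ → (lo hi vlo vhi : ℕ) → Set
EmptyBox σ lo hi vlo vhi = ∀ {m} → 0 < m → m ≤ length σ → ¬ InBox σ lo hi vlo vhi m

-- isOcc's test that a cell of the mesh is empty, with the bounds of the cell as arguments.
emptyBoxᵇ : List ℕ → (lo hi vlo vhi : ℕ) → Bool
emptyBoxᵇ σ lo hi vlo vhi =
  allB (λ m → not (between lo m hi ∧ between vlo (at σ m) vhi)) (range1 (length σ))

T-emptyBox⁻ : ∀ σ {lo hi vlo vhi} → T (emptyBoxᵇ σ lo hi vlo vhi) → EmptyBox σ lo hi vlo vhi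
T-emptyBox⁻ σ t 0<m m≤ (lo<m , m<hi , vlo<v , v<vhi) =
  T-not⇒¬T (T-allB⁻ _ t (∈-range1⁺ 0<m m≤))
    (∧-intro _ (∧-intro _ (<⇒<ᵇ lo<m) (<⇒<ᵇ m<hi)) (∧-intro _ (<⇒<ᵇ vlo<v) (<⇒<ᵇ v<vhi)))

T-emptyBox⁺ : ∀ σ {lo hi vlo vhi} → EmptyBox σ lo hi vlo vhi → T (emptyBoxᵇ σ lo hi vlo vhi)
T-emptyBox⁺ σ {lo} {hi} {vlo} {vhi} empty = T-allB⁺ _ _ λ {m} m∈ → ¬T⇒T-not λ t →
  let 0<m , m≤ = ∈-range1⁻ m∈
      t₁ , t₂ = ∧-split (between lo m hi) t
      a , b = ∧-split (lo <ᵇ m) t₁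
      c , d = ∧-split (vlo <ᵇ at σ m) t₂
  in empty 0<m m≤ (<ᵇ⇒< _ _ a , <ᵇ⇒< _ _ b , <ᵇ⇒< _ _ c , <ᵇ⇒< _ _ d)

record Occurrence (σ : List ℕ) (i j : ℕ) : Set where
  field
    i<j   : i < j
    σi<σj : at σ i < at σ j
    box₀₁ : EmptyBox σ 0 i (at σ i) (at σ j)
    box₀₂ : EmptyBox σ 0 i (at σ j) (suc (length σ))
    box₁₁ : EmptyBox σ i j (at σ i) (at σ j)
    box₁₂ : EmptyBox σ i j (at σ j) (suc (length σ))
    box₂₀ : EmptyBox σ j (suc (length σ)) 0 (at σ i)
    box₂₂ : EmptyBox σ j (suc (length σ)) (at σ j) (suc (length σ))

T-isOcc⁻ : ∀ {σ i j} → T (isOcc σ R₃₅ i j) → Occurrence σ i j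
T-isOcc⁻ {σ} {i} {j} t
  with t₁  , t ← ∧-split (i <ᵇ j) t
  with t₂  , t ← ∧-split (at σ i <ᵇ at σ j) t
  with b₀₁ , t ← ∧-split (emptyBoxᵇ σ 0 i (at σ i) (at σ j)) t
  with b₀₂ , t ← ∧-split (emptyBoxᵇ σ 0 i (at σ j) (suc (length σ))) t
  with b₁₁ , t ← ∧-split (emptyBoxᵇ σ i j (at σ i) (at σ j)) t
  with b₁₂ , t ← ∧-split (emptyBoxᵇ σ i j (at σ j) (suc (length σ))) t
  with b₂₀ , t ← ∧-split (emptyBoxᵇ σ j (suc (length σ)) 0 (at σ i)) t
  with b₂₂ , _ ← ∧-split (emptyBoxᵇ σ j (suc (length σ)) (at σ j) (suc (length σ))) t = record
  { i<j   = <ᵇ⇒< _ _ t₁          ; σi<σj = <ᵇ⇒< _ _ t₂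
  ; box₀₁ = T-emptyBox⁻ σ b₀₁ ; box₀₂ = T-emptyBox⁻ σ b₀₂ ; box₁₁ = T-emptyBox⁻ σ b₁₁
  ; box₁₂ = T-emptyBox⁻ σ b₁₂ ; box₂₀ = T-emptyBox⁻ σ b₂₀ ; box₂₂ = T-emptyBox⁻ σ b₂₂
  }

T-isOcc⁺ : ∀ {σ i j} → Occurrence σ i j → T (isOcc σ R₃₅ i j)
T-isOcc⁺ {σ} {i} {j} occ =
  ∧-intro (i <ᵇ j) (<⇒<ᵇ i<j) (∧-intro (at σ i <ᵇ at σ j) (<⇒<ᵇ σi<σj)
    (∧-intro (box 0 i σi σj) (T-emptyBox⁺ σ box₀₁) (∧-intro (box 0 i σj n+1) (T-emptyBox⁺ σ box₀₂)
    (∧-intro (box i j σi σj) (T-emptyBox⁺ σ box₁₁) (∧-intro (box i j σj n+1) (T-emptyBox⁺ σ box₁₂)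
    (∧-intro (box j n+1 0 σi) (T-emptyBox⁺ σ box₂₀) (∧-intro (box j n+1 σj n+1) (T-emptyBox⁺ σ box₂₂) _)))))))
  where
  open Occurrence occ
  σi = at σ i
  σj = at σ j
  n+1 = suc (length σ)
  box = emptyBoxᵇ σ

record MaxOccurrence (σ : List ℕ) (i j : ℕ) : Set where
  field
    0<i   : 0 < i
    i<j   : i < j
    j≤n   : j ≤ length σ
    σj≡n  : at σ j ≡ length σ
    left  : ∀ {m} → 0 < m → m < j → m ≢ i → at σ m < at σ i
    right : ∀ {m} → j < m → m ≤ length σ → at σ i < at σ m

MaxSplit : ℕ → List ℕ → Set
MaxSplit n σ = ∃₂ λ α β → σ ≡ α ++ n ∷ β × 0 < length α × (∀ {x y} → x ∈ α → y ∈ β → x < y)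

module _ {σ} (σ↭ : σ ↭ range1 (length σ)) where

  private
    n = length σ

  -- Boxes (0,2), (1,2) and (2,2) leave no position for the entry n but j;
  -- boxes (0,1), (1,1) and (2,0) then give left and right.
  occurrence⇒maxOccurrence : ∀ {i j} → 0 < i → j ≤ n → Occurrence σ i j → MaxOccurrence σ i j
  occurrence⇒maxOccurrence {i} {j} 0<i j≤n occ = record
    { 0<i = 0<i ; i<j = i<j ; j≤n = j≤n ; σj≡n = σj≡n ; left = left ; right = right }
    where
    open Occurrence occ
    0<j = <-trans 0<i i<j
    i≤n = ≤-trans (<⇒≤ i<j) j≤n

    σj≮n : ¬ at σ j < n
    σj≮n σj<n with q , 0<q , q≤n , σq≡n ← perm-at-surjective σ↭ (≤-trans 0<j j≤n) ≤-refl =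
      placed 0<q q≤n (subst (at σ j <_) (sym σq≡n) σj<n) (s≤s (≤-reflexive σq≡n))
      where
      placed : ∀ {q} → 0 < q → q ≤ n → at σ j < at σ q → at σ q < suc n → ⊥
      placed {q} 0<q q≤n above below with <-cmp q i | <-cmp q j
      ... | tri< q<i _ _  | _             = box₀₂ 0<q q≤n (0<q , q<i , above , below)
      ... | tri≈ _ refl _ | _             = <-asym σi<σj above
      ... | tri> _ _ i<q  | tri< q<j _ _  = box₁₂ 0<q q≤n (i<q , q<j , above , below)
      ... | tri> _ _ _    | tri≈ _ refl _ = <-irrefl refl above
      ... | tri> _ _ _    | tri> _ _ j<q  = box₂₂ 0<q q≤n (j<q , s≤s q≤n , above , below)

    σj≡n : at σ j ≡ n
    σj≡n = ≤-antisym (proj₂ (perm-at-bounded σ↭ 0<j j≤n)) (≮⇒≥ σj≮n)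

    left : ∀ {m} → 0 < m → m < j → m ≢ i → at σ m < at σ i
    left {m} 0<m m<j m≢i = ≤∧≢⇒< σm≤σi (m≢i ∘ perm-at-injective σ↭ 0<m m≤n 0<i i≤n)
      where
      m≤n = ≤-trans (<⇒≤ m<j) j≤n
      σm<σj : at σ m < at σ j
      σm<σj = subst (at σ m <_) (sym σj≡n) (≤∧≢⇒< (proj₂ (perm-at-bounded σ↭ 0<m m≤n))
                λ σm≡n → <-irrefl (perm-at-injective σ↭ 0<m m≤n 0<j j≤n (trans σm≡n (sym σj≡n))) m<j)
      σm≤σi : at σ m ≤ at σ i
      σm≤σi = ≮⇒≥ λ σi<σm → case <-cmp m i of λ where
        (tri< m<i _ _) → box₀₁ 0<m m≤n (0<m , m<i , σi<σm , σm<σj)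
        (tri≈ _ m≡i _) → m≢i m≡i
        (tri> _ _ i<m) → box₁₁ 0<m m≤n (i<m , m<j , σi<σm , σm<σj)

    right : ∀ {m} → j < m → m ≤ n → at σ i < at σ m
    right {m} j<m m≤n = ≤∧≢⇒< (≮⇒≥ λ σm<σi → box₂₀ 0<m m≤n (j<m , s≤s m≤n , 0<σm , σm<σi))
                              (λ σi≡σm → <-irrefl (perm-at-injective σ↭ 0<i i≤n 0<m m≤n σi≡σm) (<-trans i<j j<m))
      where
      0<m = <-trans 0<j j<m
      0<σm = proj₁ (perm-at-bounded σ↭ 0<m m≤n)

  maxOccurrence⇒occurrence : ∀ {i j} → MaxOccurrence σ i j → Occurrence σ i j
  maxOccurrence⇒occurrence {i} {j} occ = record
    { i<j   = i<j
    ; σi<σj = σi<σj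
    ; box₀₁ = λ 0<m _ (_ , m<i , σi<σm , _) → <-asym σi<σm (left 0<m (<-trans m<i i<j) (<⇒≢ m<i))
    ; box₀₂ = λ 0<m m≤n (_ , _ , σj<σm , _) → above-n 0<m m≤n σj<σm
    ; box₁₁ = λ 0<m _ (i<m , m<j , σi<σm , _) → <-asym σi<σm (left 0<m m<j (≢-sym (<⇒≢ i<m)))
    ; box₁₂ = λ 0<m m≤n (_ , _ , σj<σm , _) → above-n 0<m m≤n σj<σm
    ; box₂₀ = λ _ m≤n (j<m , _ , _ , σm<σi) → <-asym σm<σi (right j<m m≤n)
    ; box₂₂ = λ 0<m m≤n (_ , _ , σj<σm , _) → above-n 0<m m≤n σj<σm
    }
    where
    open MaxOccurrence occ
    0<j = <-trans 0<i i<j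
    i≤n = ≤-trans (<⇒≤ i<j) j≤n

    above-n : ∀ {m} → 0 < m → m ≤ n → ¬ at σ j < at σ m
    above-n 0<m m≤n σj<σm = <⇒≱ (subst (_< at σ _) σj≡n σj<σm) (proj₂ (perm-at-bounded σ↭ 0<m m≤n))

    σi<σj : at σ i < at σ j
    σi<σj = subst (at σ i <_) (sym σj≡n) (≤∧≢⇒< (proj₂ (perm-at-bounded σ↭ 0<i i≤n))
              λ σi≡n → <⇒≢ i<j (perm-at-injective σ↭ 0<i i≤n 0<j j≤n (trans σi≡n (sym σj≡n))))

  maxOccurrence-unique : ∀ {i j i′ j′} → MaxOccurrence σ i j → MaxOccurrence σ i′ j′ → i ≡ i′ × j ≡ j′
  maxOccurrence-unique occ occ′ = i≡i′ , j≡j′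
    where
    open MaxOccurrence occ
    open MaxOccurrence occ′ renaming (0<i to 0<i′; i<j to i′<j′; j≤n to j′≤n; σj≡n to σj′≡n; left to left′)
    j≡j′ = perm-at-injective σ↭ (<-trans 0<i i<j) j≤n (<-trans 0<i′ i′<j′) j′≤n (trans σj≡n (sym σj′≡n))
    i≡i′ = case _ ≟ _ of λ where
      (yes i≡i′) → i≡i′
      (no i≢i′)  → ⊥-elim (<-asym (left 0<i′ (subst (_ <_) (sym j≡j′) i′<j′) (≢-sym i≢i′))
                                  (left′ 0<i (subst (_ <_) j≡j′ i<j) i≢i′))

  maxOccurrence⇒maxSplit : ∀ {i j} → MaxOccurrence σ i j → MaxSplit n σ
  maxOccurrence⇒maxSplit {i} {suc _} occ with α , β , σ≡ , refl ← split-at σ (MaxOccurrence.j≤n occ) =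
    α , β , trans σ≡ (cong (λ v → α ++ v ∷ β) σj≡n) , ≤-trans 0<i (≤-pred i<j) ,
    λ x∈ y∈ → ≤-<-trans (α≤σi x∈) (σi<β y∈)
    where
    open MaxOccurrence occ

    α≤σi : ∀ {x} → x ∈ α → x ≤ at σ i
    α≤σi x∈ with k , k< , αk≡x ← ∈⇒at x∈
            with σk≡x ← trans (cong (λ τ → at τ (suc k)) σ≡) (trans (at-++ˡ α _ k<) αk≡x)
            with suc k ≟ i
    ... | yes refl = ≤-reflexive (sym σk≡x)
    ... | no  k≢i  = <⇒≤ (subst (_< at σ i) σk≡x (left (s≤s z≤n) (s≤s k<) k≢i))

    σi<β : ∀ {y} → y ∈ β → at σ i < y
    σi<β y∈ with r , r< , βr≡y ← ∈⇒at y∈ = subst (at σ i <_) σm≡y (right j<m m≤n)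
      where
      m = suc (length α + suc r)
      σm≡y : at σ m ≡ _
      σm≡y = trans (cong (λ τ → at τ m) σ≡) (trans (at-++ʳ α (at σ (suc (length α)) ∷ β) (suc r)) βr≡y)
      j<m : suc (length α) < m
      j<m = s≤s (m<m+n (length α) z<s)
      m≤n : m ≤ n
      m≤n = subst (m ≤_) (sym (trans (cong length σ≡) (trans (length-++ α) (+-suc (length α) (length β)))))
              (s≤s (+-monoʳ-≤ (length α) r<))

  maxSplit⇒maxOccurrence : MaxSplit n σ → ∃₂ (MaxOccurrence σ)
  maxSplit⇒maxOccurrence (α@(x ∷ _) , β , σ≡ , _ , α<β)
    with k , k< , αk≡M ← ∈⇒at (max-∈ (here refl) (proj₁ (↭range1⇒bounded σ↭ (subst (x ∈_) (sym σ≡) (here refl))))) =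
    suc k , suc (length α) , record
      { 0<i = z<s ; i<j = s≤s k< ; j≤n = j≤n ; σj≡n = σj≡n ; left = left ; right = right }
    where
    M = max 0 α
    n≡ : n ≡ suc (length α + length β)
    n≡ = trans (cong length σ≡) (trans (length-++ α) (+-suc (length α) (length β)))

    j≤n : suc (length α) ≤ n
    j≤n = subst (suc (length α) ≤_) (sym n≡) (s≤s (m≤m+n (length α) (length β)))

    before-n : ∀ {q} → q < length α → suc q ≤ n
    before-n q< = ≤-trans (m≤n⇒m≤1+n q<) j≤n

    σ≡α : ∀ {q} → q < length α → at σ (suc q) ≡ at α (suc q)
    σ≡α q< = trans (cong (λ τ → at τ (suc _)) σ≡) (at-++ˡ α _ q<)

    σj≡n : at σ (suc (length α)) ≡ n
    σj≡n = trans (cong (λ τ → at τ (suc (length α))) σ≡)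
                 (subst (λ q → at (α ++ n ∷ β) (suc q) ≡ n) (+-identityʳ (length α)) (at-++ʳ α (n ∷ β) 0))

    σi≡M : at σ (suc k) ≡ M
    σi≡M = trans (σ≡α k<) αk≡M

    left : ∀ {m} → 0 < m → m < suc (length α) → m ≢ suc k → at σ m < at σ (suc k)
    left {suc m} _ (s≤s m<) m≢i = ≤∧≢⇒< σm≤σi (m≢i ∘ perm-at-injective σ↭ z<s (before-n m<) z<s (before-n k<))
      where
      σm≤σi : at σ (suc m) ≤ at σ (suc k)
      σm≤σi = subst₂ _≤_ (sym (σ≡α m<)) (sym σi≡M) (All.lookup (xs≤max 0 α) (at-∈ α m<))

    right : ∀ {m} → suc (length α) < m → m ≤ n → at σ (suc k) < at σ m
    right j<m m≤n with o , refl ← m≤n⇒∃[o]m+o≡n j<m =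
      subst₂ _<_ (sym σi≡M) (sym σm≡βo) (α<β (subst (_∈ α) αk≡M (at-∈ α k<)) (at-∈ β o<))
      where
      σm≡βo : at σ (suc (suc (length α + o))) ≡ at β (suc o)
      σm≡βo = trans (cong (λ τ → at τ _) σ≡)
                    (subst (λ q → at (α ++ n ∷ β) (suc q) ≡ at β (suc o)) (+-suc (length α) o)
                           (at-++ʳ α (n ∷ β) (suc o)))
      o< : o < length β
      o< = +-cancelˡ-< (length α) o (length β) (≤-pred (subst (_ ≤_) n≡ m≤n))

occursAt : List ℕ → ℕ × ℕ → Bool
occursAt σ ij = isOcc σ R₃₅ (proj₁ ij) (proj₂ ij)

occurrences : List ℕ → List (ℕ × ℕ)
occurrences σ = filterᵇ (occursAt σ) (cartesianProduct (range1 (length σ)) (range1 (length σ)))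

p≡length-occurrences : ∀ σ → p σ ≡ length (occurrences σ)
p≡length-occurrences σ =
  cong (length ∘ filterᵇ (occursAt σ)) (concatMap-pairs (range1 (length σ)) (range1 (length σ)))

module _ {σ} (σ↭ : σ ↭ range1 (length σ)) where

  private
    n = length σ

  ∈-occurrences⁻ : ∀ {i j} → (i , j) ∈ occurrences σ → MaxOccurrence σ i j
  ∈-occurrences⁻ ij∈ with ij∈pairs , t ← ∈-filterᵇ⁻ (occursAt σ) ij∈
                     with i∈ , j∈ ← ∈-cartesianProduct⁻ (range1 n) (range1 n) ij∈pairs =
    occurrence⇒maxOccurrence σ↭ (proj₁ (∈-range1⁻ i∈)) (proj₂ (∈-range1⁻ j∈)) (T-isOcc⁻ t)

  p≤1 : p σ ≤ 1
  p≤1 = subst (_≤ 1) (sym (p≡length-occurrences σ)) (unique∧constant⇒length≤1 occurrences-unique same)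
    where
    occurrences-unique : Unique (occurrences σ)
    occurrences-unique =
      filterᵇ-unique (occursAt σ) (Unique.cartesianProduct⁺ (range1-unique n) (range1-unique n))
    same : ∀ {ij ij′} → ij ∈ occurrences σ → ij′ ∈ occurrences σ → ij ≡ ij′
    same {_ , _} {_ , _} ij∈ ij′∈ =
      uncurry (cong₂ _,_) (maxOccurrence-unique σ↭ (∈-occurrences⁻ ij∈) (∈-occurrences⁻ ij′∈))

  p>0⇒maxSplit : 0 < p σ → MaxSplit (length σ) σ
  p>0⇒maxSplit 0<p with occurrences σ in eq | p≡length-occurrences σ
  ... | []     | p≡0 = ⊥-elim (<-irrefl refl (subst (0 <_) p≡0 0<p))
  ... | ij ∷ _ | _   = maxOccurrence⇒maxSplit σ↭ (∈-occurrences⁻ (subst (ij ∈_) (sym eq) (here refl)))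

  maxSplit⇒p≡1 : MaxSplit (length σ) σ → p σ ≡ 1
  maxSplit⇒p≡1 split with i , j , occ ← maxSplit⇒maxOccurrence σ↭ split =
    ≤-antisym (p≤1) (subst (0 <_) (sym (p≡length-occurrences σ)) (∈-length ij∈))
    where
    open MaxOccurrence occ
    ij∈ : (i , j) ∈ occurrences σ
    ij∈ = ∈-filterᵇ⁺ (occursAt σ)
            (∈-cartesianProduct⁺ (∈-range1⁺ 0<i (≤-trans (<⇒≤ i<j) j≤n)) (∈-range1⁺ (<-trans 0<i i<j) j≤n))
            (T-isOcc⁺ (maxOccurrence⇒occurrence σ↭ occ))

-- King permutations

startsWith : ℕ → List ℕ → Bool
startsWith k []      = false
startsWith k (x ∷ _) = x ≡ᵇ k

endsWith : ℕ → List ℕ → Bool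
endsWith k []           = false
endsWith k (x ∷ [])     = x ≡ᵇ k
endsWith k (x ∷ y ∷ xs) = endsWith k (y ∷ xs)

endsWith-++-∷ : ∀ k u x w → endsWith k (u ++ x ∷ w) ≡ endsWith k (x ∷ w)
endsWith-++-∷ k []           x w = refl
endsWith-++-∷ k (a ∷ [])     x w = refl
endsWith-++-∷ k (a ∷ b ∷ u)  x w = endsWith-++-∷ k (b ∷ u) x w

endsWith-< : ∀ {k} σ → All (_< k) σ → ¬ T (endsWith k σ)
endsWith-< (x ∷ [])    (x<k ∷ []) t = <⇒≢ x<k (≡ᵇ⇒≡ _ _ t)
endsWith-< (x ∷ y ∷ σ) (_ ∷ σ<k)    = endsWith-< (y ∷ σ) σ<k

apart-suc : ∀ {a n} → a ≤ n → (1 <ᵇ ∣ a - suc n ∣) ≡ not (a ≡ᵇ n)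
apart-suc {zero}  {zero}  _         = refl
apart-suc {zero}  {suc n} _         = refl
apart-suc {suc a} {suc n} (s≤s a≤n) = apart-suc a≤n

isKing-∷-max : ∀ {n} β → All (_≤ n) β → isKing (suc n ∷ β) ≡ not (startsWith n β) ∧ isKing β
isKing-∷-max         []      _         = refl
isKing-∷-max {n} (b ∷ β) (b≤n ∷ _) =
  cong (_∧ isKing (b ∷ β)) (trans (cong (1 <ᵇ_) (∣-∣-comm (suc n) b)) (apart-suc b≤n))

isKing-∷ʳ-max : ∀ {n} α → All (_≤ n) α → isKing (α ∷ʳ suc n) ≡ isKing α ∧ not (endsWith n α)
isKing-∷ʳ-max []          _            = refl
isKing-∷ʳ-max (a ∷ [])    (a≤n ∷ [])   = trans (∧-identityʳ _) (apart-suc a≤n)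
isKing-∷ʳ-max (a ∷ b ∷ α) (_ ∷ α≤n) =
  trans (cong ((1 <ᵇ ∣ a - b ∣) ∧_) (isKing-∷ʳ-max (b ∷ α) α≤n)) (sym (∧-assoc (1 <ᵇ ∣ a - b ∣) _ _))

isKing-++-∷ : ∀ α x γ → isKing (α ++ x ∷ γ) ≡ isKing (α ∷ʳ x) ∧ isKing (x ∷ γ)
isKing-++-∷ []          x γ = refl
isKing-++-∷ (a ∷ [])    x γ = cong (_∧ isKing (x ∷ γ)) (sym (∧-identityʳ _))
isKing-++-∷ (a ∷ b ∷ α) x γ =
  trans (cong ((1 <ᵇ ∣ a - b ∣) ∧_) (isKing-++-∷ (b ∷ α) x γ)) (sym (∧-assoc (1 <ᵇ ∣ a - b ∣) _ _))

isKing-map-+ : ∀ m σ → isKing (map (m +_) σ) ≡ isKing σ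
isKing-map-+ m []          = refl
isKing-map-+ m (a ∷ [])    = refl
isKing-map-+ m (a ∷ b ∷ σ) = cong₂ _∧_ (cong (1 <ᵇ_) (∣m+n-m+o∣≡∣n-o∣ m a b)) (isKing-map-+ m (b ∷ σ))

K-headNot : ℕ → ℕ → List (List ℕ)
K-headNot v k = filterᵇ (not ∘ startsWith v) (K k)

K-lastNot : ℕ → ℕ → List (List ℕ)
K-lastNot v k = filterᵇ (not ∘ endsWith v) (K k)

∈-filterK⁻ : ∀ g n {σ} → σ ∈ filterᵇ g (K n) → σ ∈ perms n × T (isKing σ) × T (g σ)
∈-filterK⁻ g n σ∈ with σ∈K , gσ ← ∈-filterᵇ⁻ g σ∈ with σ∈perms , king ← ∈-filterᵇ⁻ isKing σ∈K =
  σ∈perms , king , gσ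

∈-filterK⁺ : ∀ g n {σ} → σ ∈ perms n → T (isKing σ) → T (g σ) → σ ∈ filterᵇ g (K n)
∈-filterK⁺ g n σ∈ king gσ = ∈-filterᵇ⁺ g (∈-filterᵇ⁺ isKing σ∈ king) gσ

filterK-unique : ∀ g n → Unique (filterᵇ g (K n))
filterK-unique g n = filterᵇ-unique g (filterᵇ-unique isKing (perms-unique n))

length-K-startsWith-max : ∀ k →
  length (filterᵇ (startsWith (suc k)) (K (suc k))) ≡ length (K-headNot k k)
length-K-startsWith-max k =
  sym (bijection⇒length≡ (suc k ∷_) (filterK-unique _ k) (filterK-unique _ (suc k))
         (λ _ _ → ∷-injectiveʳ) into onto)
  where
  into : ∀ {τ} → τ ∈ K-headNot k k → suc k ∷ τ ∈ filterᵇ (startsWith (suc k)) (K (suc k))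
  into {τ} τ∈ with τ∈perms , king , ¬start ← ∈-filterK⁻ (not ∘ startsWith k) k τ∈ =
    ∈-filterK⁺ (startsWith (suc k)) (suc k) (∈-perms-suc⁺ [] τ τ∈perms)
      (subst T (sym (isKing-∷-max τ (∈-perms⇒All≤ τ∈perms))) (∧-intro _ ¬start king))
      (≡⇒≡ᵇ (suc k) (suc k) refl)

  onto : ∀ {σ} → σ ∈ filterᵇ (startsWith (suc k)) (K (suc k)) →
         ∃ λ τ → τ ∈ K-headNot k k × σ ≡ suc k ∷ τ
  onto σ∈ with σ∈perms , king , start ← ∈-filterK⁻ (startsWith (suc k)) (suc k) σ∈
          with ∈-perms-suc⁻ {k} σ∈perms
  ... | [] , τ , refl , τ∈ =
    let ¬start , kingτ = ∧-split _ (subst T (isKing-∷-max τ (∈-perms⇒All≤ τ∈)) king)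
    in τ , ∈-filterK⁺ (not ∘ startsWith k) k τ∈ kingτ ¬start , refl
  ... | a ∷ _ , _ , refl , uv∈ =
    ⊥-elim (1+n≰n (subst (_≤ k) (≡ᵇ⇒≡ a (suc k) start) (∈-perms⇒≤ uv∈ (here refl))))

length-K-endsWith-max : ∀ k →
  length (filterᵇ (endsWith (suc k)) (K (suc k))) ≡ length (K-lastNot k k)
length-K-endsWith-max k =
  sym (bijection⇒length≡ (_∷ʳ suc k) (filterK-unique _ k) (filterK-unique _ (suc k))
         (λ _ _ eq → proj₁ (∷ʳ-injective _ _ eq)) into onto)
  where
  ends : ∀ τ → T (endsWith (suc k) (τ ∷ʳ suc k))
  ends τ = subst T (sym (endsWith-++-∷ (suc k) τ (suc k) [])) (≡⇒≡ᵇ (suc k) (suc k) refl)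

  into : ∀ {τ} → τ ∈ K-lastNot k k → τ ∷ʳ suc k ∈ filterᵇ (endsWith (suc k)) (K (suc k))
  into {τ} τ∈ with τ∈perms , king , ¬end ← ∈-filterK⁻ (not ∘ endsWith k) k τ∈ =
    ∈-filterK⁺ (endsWith (suc k)) (suc k)
      (∈-perms-suc⁺ τ [] (subst (_∈ perms k) (sym (++-identityʳ τ)) τ∈perms))
      (subst T (sym (isKing-∷ʳ-max τ (∈-perms⇒All≤ τ∈perms))) (∧-intro _ king ¬end))
      (ends τ)

  onto : ∀ {σ} → σ ∈ filterᵇ (endsWith (suc k)) (K (suc k)) →
         ∃ λ τ → τ ∈ K-lastNot k k × σ ≡ τ ∷ʳ suc k
  onto σ∈ with σ∈perms , king , end ← ∈-filterK⁻ (endsWith (suc k)) (suc k) σ∈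
          with ∈-perms-suc⁻ {k} σ∈perms
  ... | τ , [] , refl , τ[]∈ =
    let τ∈ = subst (_∈ perms k) (++-identityʳ τ) τ[]∈
        kingτ , ¬end = ∧-split _ (subst T (isKing-∷ʳ-max τ (∈-perms⇒All≤ τ∈)) king)
    in τ , ∈-filterK⁺ (not ∘ endsWith k) k τ∈ kingτ ¬end , refl
  ... | u , c ∷ w , refl , uv∈ = ⊥-elim
    (endsWith-< (c ∷ w) (All.tabulate (λ y∈ → s≤s (∈-perms⇒≤ uv∈ (∈-++⁺ʳ u y∈))))
      (subst T (endsWith-++-∷ (suc k) u (suc k) (c ∷ w)) end))

length-K-headNot-recurrence : ∀ k →
  length (K-headNot k k) + length (K-headNot (suc k) (suc k)) ≡ length (K (suc k))
length-K-headNot-recurrence k =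
  trans (cong (_+ length (K-headNot (suc k) (suc k))) (sym (length-K-startsWith-max k)))
        (length-filterᵇ-not (startsWith (suc k)) (K (suc k)))

length-K-lastNot-recurrence : ∀ k →
  length (K-lastNot k k) + length (K-lastNot (suc k) (suc k)) ≡ length (K (suc k))
length-K-lastNot-recurrence k =
  trans (cong (_+ length (K-lastNot (suc k) (suc k))) (sym (length-K-endsWith-max k)))
        (length-filterᵇ-not (endsWith (suc k)) (K (suc k)))

length-K-lastNot-< : ∀ {v m} → m < v → length (K-lastNot v m) ≡ length (K m)
length-K-lastNot-< {v} {m} m<v =
  cong length (filter-all (T? ∘ (not ∘ endsWith v)) (All.tabulate not-last))
  where
  not-last : ∀ {α} → α ∈ K m → T (not (endsWith v α))
  not-last α∈ = ¬T⇒T-not (endsWith-< _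
    (All.map (λ x≤m → ≤-<-trans x≤m m<v) (∈-perms⇒All≤ (proj₁ (∈-filterᵇ⁻ isKing α∈)))))

-- King permutations with one occurrence

isKing-glue : ∀ {m k n α β} → α ∈ perms m → β ∈ perms k → m + k ≡ n →
              isKing (α ++ suc n ∷ map (m +_) β)
                ≡ (isKing α ∧ not (endsWith n α)) ∧ (not (startsWith k β) ∧ isKing β)
isKing-glue {m} {k} {_} {α} {β} α∈ β∈ refl = begin
  isKing (α ++ suc (m + k) ∷ map (m +_) β)
    ≡⟨ isKing-++-∷ α (suc (m + k)) (map (m +_) β) ⟩
  isKing (α ∷ʳ suc (m + k)) ∧ isKing (suc (m + k) ∷ map (m +_) β)
    ≡⟨ cong₂ _∧_ (isKing-∷ʳ-max α (All.map (λ x≤m → ≤-trans x≤m (m≤m+n m k)) (∈-perms⇒All≤ α∈)))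
                 (trans (cong (λ x → isKing (x ∷ map (m +_) β)) (sym (+-suc m k))) (isKing-map-+ m (suc k ∷ β))) ⟩
  (isKing α ∧ not (endsWith (m + k) α)) ∧ isKing (suc k ∷ β)
    ≡⟨ cong ((isKing α ∧ not (endsWith (m + k) α)) ∧_) (isKing-∷-max β (∈-perms⇒All≤ β∈)) ⟩
  (isKing α ∧ not (endsWith (m + k) α)) ∧ (not (startsWith k β) ∧ isKing β)
    ∎
  where open ≡-Reasoning

module _ {m k n α β} (α∈ : α ∈ perms m) (β∈ : β ∈ perms k) (m+k≡n : m + k ≡ n) where

  T-isKing-glue⁻ : T (isKing (α ++ suc n ∷ map (m +_) β)) → α ∈ K-lastNot n m × β ∈ K-headNot k k
  T-isKing-glue⁻ king =
    let left , right = ∧-split _ (subst T (isKing-glue α∈ β∈ m+k≡n) king)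
        kingα , ¬end = ∧-split _ left
        ¬start , kingβ = ∧-split _ right
    in ∈-filterK⁺ (not ∘ endsWith n) m α∈ kingα ¬end , ∈-filterK⁺ (not ∘ startsWith k) k β∈ kingβ ¬start

  T-isKing-glue⁺ : α ∈ K-lastNot n m → β ∈ K-headNot k k → T (isKing (α ++ suc n ∷ map (m +_) β))
  T-isKing-glue⁺ α∈L β∈H =
    let _ , kingα , ¬end = ∈-filterK⁻ (not ∘ endsWith n) m α∈L
        _ , kingβ , ¬start = ∈-filterK⁻ (not ∘ startsWith k) k β∈H
    in subst T (sym (isKing-glue α∈ β∈ m+k≡n)) (∧-intro _ (∧-intro _ kingα ¬end) (∧-intro _ ¬start kingβ))

-- (α , β) stands for α (n+1) β′ with β′ the list β shifted above α. By isKing-glue the only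
-- junction constraints are that α does not end in n and β does not start with its maximum.
glue : ℕ → List ℕ × List ℕ → List ℕ
glue n (α , β) = α ++ suc n ∷ map (length α +_) β

splits : ℕ → List (List ℕ × List ℕ)
splits n = concatMap (λ k → cartesianProduct (K-lastNot n (n ∸ k)) (K-headNot k k)) (upTo n)

module _ {n : ℕ} where

  ∈-splits⁺ : ∀ {k α β} → k < n → α ∈ K-lastNot n (n ∸ k) → β ∈ K-headNot k k → (α , β) ∈ splits n
  ∈-splits⁺ k<n α∈ β∈ = ∈-concatMap⁺ _ (lose (∈-upTo⁺ k<n) (∈-cartesianProduct⁺ α∈ β∈))

  ∈-splits⁻ : ∀ {α β} → (α , β) ∈ splits n →
              ∃ λ k → k < n × α ∈ K-lastNot n (n ∸ k) × β ∈ K-headNot k k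
  ∈-splits⁻ αβ∈ with k , k∈ , αβ∈k ← find (∈-concatMap⁻ _ {xs = upTo n} αβ∈) =
    k , ∈-upTo⁻ k∈ , ∈-cartesianProduct⁻ (K-lastNot n (n ∸ k)) (K-headNot k k) αβ∈k

  splits-unique : Unique (splits n)
  splits-unique = concatMap-unique _ (Unique.upTo⁺ n)
    (λ {k} _ → Unique.cartesianProduct⁺ (filterK-unique _ (n ∸ k)) (filterK-unique _ k))
    λ {k} {k′} {αβ} _ _ αβ∈k αβ∈k′ → trans (sym (suffix-length k αβ∈k)) (suffix-length k′ αβ∈k′)
    where
    suffix-length : ∀ k {αβ} → αβ ∈ cartesianProduct (K-lastNot n (n ∸ k)) (K-headNot k k) →
                    length (proj₂ αβ) ≡ k
    suffix-length k {_ , _} αβ∈ =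
      ∈-perms⇒length (proj₁ (∈-filterK⁻ _ k (proj₂ (∈-cartesianProduct⁻ (K-lastNot n (n ∸ k)) _ αβ∈))))

K-p≡1 : ℕ → List (List ℕ)
K-p≡1 n = filterᵇ (λ σ → p σ ≡ᵇ 1) (K n)

glue∈K-p≡1 : ∀ {m k n α β} → 0 < m → m + k ≡ n → α ∈ K-lastNot n m → β ∈ K-headNot k k →
             α ++ suc n ∷ map (m +_) β ∈ K-p≡1 (suc n)
glue∈K-p≡1 {m} {k} {n} {α} {β} 0<m m+k≡n α∈L β∈H =
  ∈-filterK⁺ (λ σ → p σ ≡ᵇ 1) (suc n) σ∈ (T-isKing-glue⁺ α∈ β∈ m+k≡n α∈L β∈H)
    (≡⇒≡ᵇ _ _ (maxSplit⇒p≡1 (∈-perms⇒↭range1-length {suc n} σ∈) split))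
  where
  α∈ = proj₁ (∈-filterK⁻ _ m α∈L)
  β∈ = proj₁ (∈-filterK⁻ _ k β∈H)
  σ = α ++ suc n ∷ map (m +_) β

  σ∈ : σ ∈ perms (suc n)
  σ∈ = ∈-perms-suc⁺ α _ (subst (λ l → α ++ map (m +_) β ∈ perms l) m+k≡n (∈-perms-++⁺ α∈ β∈))

  α<β : ∀ {x y} → x ∈ α → y ∈ map (m +_) β → x < y
  α<β x∈ y∈ with b , b∈ , refl ← ∈-map⁻ (m +_) y∈ =
    ≤-<-trans (∈-perms⇒≤ α∈ x∈) (m<m+n m (proj₁ (↭range1⇒bounded (perms-sound {k} β∈) b∈)))

  split : MaxSplit (length σ) σ
  split = α , map (m +_) β , cong (λ l → α ++ l ∷ map (m +_) β) (sym (∈-perms⇒length σ∈)) ,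
          subst (0 <_) (sym (∈-perms⇒length α∈)) 0<m , α<β

∈-splits⇒1+n∉ : ∀ {n α β} → (α , β) ∈ splits n → suc n ∉ α
∈-splits⇒1+n∉ {n} αβ∈ n+1∈ with k , _ , α∈L , _ ← ∈-splits⁻ {n} αβ∈ =
  1+n≰n (≤-trans (∈-perms⇒≤ (proj₁ (∈-filterK⁻ _ (n ∸ k) α∈L)) n+1∈) (m∸n≤m n k))

glue-injective : ∀ n → InjectiveOn (glue n) (splits n)
glue-injective n {α , β} {α′ , β′} αβ∈ αβ′∈ eq
  with refl , eq′ ← ++-∷-injective α α′ (∈-splits⇒1+n∉ αβ∈) (∈-splits⇒1+n∉ αβ′∈) eq =
  cong (α ,_) (map-injective (+-cancelˡ-≡ (length α) _ _) eq′)

splits⇒K-p≡1 : ∀ {n αβ} → αβ ∈ splits n → glue n αβ ∈ K-p≡1 (suc n)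
splits⇒K-p≡1 {n} {α , β} αβ∈ with k , k<n , α∈L , β∈H ← ∈-splits⁻ {n} αβ∈ =
  subst (λ l → α ++ suc n ∷ map (l +_) β ∈ K-p≡1 (suc n))
        (sym (∈-perms⇒length (proj₁ (∈-filterK⁻ _ (n ∸ k) α∈L))))
    (glue∈K-p≡1 (m<n⇒0<n∸m k<n) (m∸n+n≡m (<⇒≤ k<n)) α∈L β∈H)

K-p≡1⇒splits : ∀ {n σ} → σ ∈ K-p≡1 (suc n) → ∃ λ αβ → αβ ∈ splits n × σ ≡ glue n αβ
K-p≡1⇒splits {n} {σ} σ∈
  with σ∈perms , king , p≡1 ← ∈-filterK⁻ (λ σ → p σ ≡ᵇ 1) (suc n) σ∈
  with α , γ , σ≡ , 0<|α| , α<γ ← p>0⇒maxSplit (∈-perms⇒↭range1-length {suc n} σ∈perms)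
                                    (subst (0 <_) (sym (≡ᵇ⇒≡ (p σ) 1 p≡1)) z<s)
  with σ≡α++n+1∷γ ← trans σ≡ (cong (λ l → α ++ l ∷ γ) (∈-perms⇒length σ∈perms))
  with u , v , σ≡u++n+1∷v , uv∈ ← ∈-perms-suc⁻ {n} σ∈perms
  with refl , refl ← ++-∷-injective α u
         (++-∷-unique⇒∉ α (subst Unique σ≡α++n+1∷γ (↭range1⇒unique (perms-sound {suc n} σ∈perms))))
         (λ n+1∈ → 1+n≰n (∈-perms⇒≤ uv∈ (∈-++⁺ˡ n+1∈)))
         (trans (sym σ≡α++n+1∷γ) σ≡u++n+1∷v)
  with α∈ , β , refl , β∈ ← ∈-perms-++⁻ {n} uv∈ α<γ =
  (α , β) , ∈-splits⁺ {n} k<n (subst (λ l → α ∈ K-lastNot n l) (sym n∸k≡m) α∈L) β∈H , σ≡α++n+1∷γ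
  where
  m = length α
  k = length (map (m +_) β)
  m+k≡n : m + k ≡ n
  m+k≡n = trans (sym (length-++ α)) (∈-perms⇒length uv∈)
  k<n : k < n
  k<n = subst (k <_) (trans (+-comm k m) m+k≡n) (m<m+n k 0<|α|)
  n∸k≡m : n ∸ k ≡ m
  n∸k≡m = trans (cong (_∸ k) (sym m+k≡n)) (m+n∸n≡m m k)
  glued = T-isKing-glue⁻ α∈ β∈ m+k≡n (subst (T ∘ isKing) σ≡α++n+1∷γ king)
  α∈L = proj₁ glued
  β∈H = proj₂ glued

length-K-p≡1 : ∀ n → length (K-p≡1 (suc n)) ≡ length (splits n)
length-K-p≡1 n = sym (bijection⇒length≡ (glue n) (splits-unique {n}) (filterK-unique _ (suc n))
                                       (glue-injective n) splits⇒K-p≡1 K-p≡1⇒splits)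

∈-K⇒p≤1 : ∀ {n σ} → σ ∈ K n → p σ ≤ 1
∈-K⇒p≤1 {n} σ∈ = p≤1 (∈-perms⇒↭range1-length {n} (proj₁ (∈-filterᵇ⁻ isKing σ∈)))

length-K-p≡0+p≡1 : ∀ n → length (filterᵇ (λ σ → p σ ≡ᵇ 0) (K n)) + length (K-p≡1 n) ≡ length (K n)
length-K-p≡0+p≡1 n = trans (cong (length (filterᵇ (λ σ → p σ ≡ᵇ 0) (K n)) +_) (cong length (sym not-p≡0)))
                           (length-filterᵇ-not (λ σ → p σ ≡ᵇ 0) (K n))
  where
  ≤1⇒not≡0 : ∀ {m} → m ≤ 1 → not (m ≡ᵇ 0) ≡ (m ≡ᵇ 1)
  ≤1⇒not≡0 z≤n       = refl
  ≤1⇒not≡0 (s≤s z≤n) = refl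
  not-p≡0 : filterᵇ (not ∘ (λ σ → p σ ≡ᵇ 0)) (K n) ≡ K-p≡1 n
  not-p≡0 = filterᵇ-cong (K n) (≤1⇒not≡0 ∘ ∈-K⇒p≤1 {n})

K-p≥2≡[] : ∀ n k → filterᵇ (λ σ → p σ ≡ᵇ suc (suc k)) (K n) ≡ []
K-p≥2≡[] n k = filter-none (T? ∘ (λ σ → p σ ≡ᵇ suc (suc k))) {K n} (All.tabulate λ σ∈ t →
  <⇒≱ (s≤s (s≤s z≤n)) (subst (_≤ 1) (≡ᵇ⇒≡ _ _ t) (∈-K⇒p≤1 {n} σ∈)))

-- Coefficients

-- Integer notation is opened only in this block: ℤ's prefix +_ makes ℕ sections like m +_ ambiguous.
module _ where

  open import Data.Integer using (ℤ; +_; -_; _-_)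
  import Data.Integer as ℤ
  import Data.Integer.Properties as ℤ
  open import Data.Integer.Tactic.RingSolver using (solve-∀)

  sumTo-cong : ∀ n {f g : ℕ → ℤ} → (∀ {i} → i < n → f i ≡ g i) → sumTo n f ≡ sumTo n g
  sumTo-cong zero    _   = refl
  sumTo-cong (suc n) f≡g = cong₂ ℤ._+_ (sumTo-cong n (f≡g ∘ m<n⇒m<1+n)) (f≡g ≤-refl)

  sumTo-zero : ∀ n {f : ℕ → ℤ} → (∀ {i} → i < n → f i ≡ + 0) → sumTo n f ≡ + 0
  sumTo-zero zero    _   = refl
  sumTo-zero (suc n) f≡0 = cong₂ ℤ._+_ (sumTo-zero n (f≡0 ∘ m<n⇒m<1+n)) (f≡0 ≤-refl)

  sumTo-+ : ∀ n (f g : ℕ → ℤ) → sumTo n (λ i → f i ℤ.+ g i) ≡ sumTo n f ℤ.+ sumTo n g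
  sumTo-+ zero    f g = refl
  sumTo-+ (suc n) f g =
    trans (cong (ℤ._+ (f n ℤ.+ g n)) (sumTo-+ n f g)) (interchange (sumTo n f) (sumTo n g) (f n) (g n))
    where
    interchange : ∀ a b c d → (a ℤ.+ b) ℤ.+ (c ℤ.+ d) ≡ (a ℤ.+ c) ℤ.+ (b ℤ.+ d)
    interchange = solve-∀

  sumTo-neg : ∀ n (f : ℕ → ℤ) → sumTo n (λ i → - f i) ≡ - sumTo n f
  sumTo-neg zero    f = refl
  sumTo-neg (suc n) f = trans (cong (ℤ._+ - f n) (sumTo-neg n f)) (sym (ℤ.neg-distrib-+ (sumTo n f) (f n)))

  sumTo-unfoldˡ : ∀ n (f : ℕ → ℤ) → sumTo (suc n) f ≡ f 0 ℤ.+ sumTo n (f ∘ suc)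
  sumTo-unfoldˡ zero    f = trans (ℤ.+-identityˡ (f 0)) (sym (ℤ.+-identityʳ (f 0)))
  sumTo-unfoldˡ (suc n) f = trans (cong (ℤ._+ f (suc n)) (sumTo-unfoldˡ n f)) (ℤ.+-assoc (f 0) _ _)

  sumTo-only-last : ∀ n {f : ℕ → ℤ} → (∀ {i} → i < n → f i ≡ + 0) → sumTo (suc n) f ≡ f n
  sumTo-only-last n {f} f≡0 = trans (cong (ℤ._+ f n) (sumTo-zero n f≡0)) (ℤ.+-identityˡ (f n))

  sumTo-only-first : ∀ n {f : ℕ → ℤ} → (∀ {i} → i < n → f (suc i) ≡ + 0) → sumTo (suc n) f ≡ f 0
  sumTo-only-first n {f} f≡0 =
    trans (sumTo-unfoldˡ n f) (trans (cong (λ s → f 0 ℤ.+ s) (sumTo-zero n f≡0)) (ℤ.+-identityʳ (f 0)))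

  sumTo-rotate : ∀ m {f g : ℕ → ℤ} → f 0 ≡ g m → (∀ {k} → k < m → f (suc k) ≡ g k) →
                 sumTo (suc m) f ≡ sumTo (suc m) g
  sumTo-rotate m {f} {g} f₀≡gₘ f∘suc≡g = begin
    sumTo (suc m) f            ≡⟨ sumTo-unfoldˡ m f ⟩
    f 0 ℤ.+ sumTo m (f ∘ suc)  ≡⟨ cong₂ ℤ._+_ f₀≡gₘ (sumTo-cong m f∘suc≡g) ⟩
    g m ℤ.+ sumTo m g          ≡⟨ ℤ.+-comm (g m) (sumTo m g) ⟩
    sumTo (suc m) g            ∎
    where open ≡-Reasoning

  shift : Series → Series
  shift g zero    = + 0
  shift g (suc n) = g n

  tS-⊛ : ∀ g n → (tS ⊛ g) n ≡ shift g n
  tS-⊛ g zero    = refl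
  tS-⊛ g (suc n) = begin
    sumTo (suc (suc n)) (λ i → tS i ℤ.* g (suc n ∸ i))  ≡⟨ sumTo-unfoldˡ (suc n) _ ⟩
    + 0 ℤ.+ sumTo (suc n) (λ i → tS (suc i) ℤ.* g (n ∸ i)) ≡⟨ ℤ.+-identityˡ _ ⟩
    sumTo (suc n) (λ i → tS (suc i) ℤ.* g (n ∸ i))      ≡⟨ sumTo-only-first n (λ _ → refl) ⟩
    + 1 ℤ.* g n                                         ≡⟨ ℤ.*-identityˡ (g n) ⟩
    g n                                                 ∎
    where open ≡-Reasoning

  shift-⊛ : ∀ h g n → (shift h ⊛ g) n ≡ shift (h ⊛ g) n
  shift-⊛ h g zero    = refl
  shift-⊛ h g (suc n) = trans (sumTo-unfoldˡ (suc n) _) (ℤ.+-identityˡ _)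

  ⊛-constantˡ : ∀ h g n → (∀ r → h (suc r) ≡ + 0) → (h ⊛ g) n ≡ h 0 ℤ.* g n
  ⊛-constantˡ h g n h≡0 = sumTo-only-first n (λ {i} _ → cong (ℤ._* g (n ∸ suc i)) (h≡0 i))

  ⊛ᵇ-lift : ∀ F g n k → (F ⊛ᵇ lift g) n k ≡ sumTo (suc n) (λ i → F i k ℤ.* g (n ∸ i))
  ⊛ᵇ-lift F g n k = sumTo-cong (suc n) λ {i} _ →
    trans (sumTo-only-last k λ {j} j<k →
             trans (cong (F i j ℤ.*_) (lift-vanishes (n ∸ i) j<k)) (ℤ.*-zeroʳ (F i j)))
          (cong (λ r → F i k ℤ.* lift g (n ∸ i) r) (n∸n≡0 k))
    where
    lift-vanishes : ∀ r {j} → j < k → lift g r (k ∸ j) ≡ + 0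
    lift-vanishes r {j} j<k with k ∸ j | m<n⇒0<n∸m j<k
    ... | suc _ | _ = refl

  lift-⊛ᵇ : ∀ f G n k → (lift f ⊛ᵇ G) n k ≡ sumTo (suc n) (λ i → f i ℤ.* G (n ∸ i) k)
  lift-⊛ᵇ f G n k = sumTo-cong (suc n) λ _ → sumTo-only-first k λ _ → refl

  lift-tS-⊛ᵇ : ∀ G n k → (lift tS ⊛ᵇ G) n k ≡ shift (λ i → G i k) n
  lift-tS-⊛ᵇ G n k = trans (lift-⊛ᵇ tS G n k) (tS-⊛ (λ i → G i k) n)

  uS-⊛ᵇ : ∀ G n k → (uS ⊛ᵇ G) n k ≡ shift (G n) k
  uS-⊛ᵇ G n k = begin
    (uS ⊛ᵇ G) n k
      ≡⟨ sumTo-only-first n (λ _ → sumTo-zero (suc k) λ _ → refl) ⟩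
    sumTo (suc k) (λ j → uS 0 j ℤ.* G n (k ∸ j))
      ≡⟨ sumTo-cong (suc k) (λ {j} _ → cong (ℤ._* G n (k ∸ j)) (uS₀≡tS j)) ⟩
    (tS ⊛ G n) k
      ≡⟨ tS-⊛ (G n) k ⟩
    shift (G n) k
      ∎
    where
    open ≡-Reasoning
    uS₀≡tS : ∀ j → uS 0 j ≡ tS j
    uS₀≡tS 0             = refl
    uS₀≡tS 1             = refl
    uS₀≡tS (suc (suc _)) = refl

  B : Series
  B = A ⊛ inv1+t

  B-suc : ∀ m → B (suc m) ≡ A (suc m) - B m
  B-suc m = begin
    sumTo (suc m) (λ i → A i ℤ.* inv1+t (suc m ∸ i)) ℤ.+ A (suc m) ℤ.* inv1+t (m ∸ m)
      ≡⟨ cong₂ ℤ._+_ (sumTo-cong (suc m) (λ {i} i≤m → cong (λ r → A i ℤ.* inv1+t r) (+-∸-assoc 1 (≤-pred i≤m))))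
                     (cong (λ r → A (suc m) ℤ.* inv1+t r) (n∸n≡0 m)) ⟩
    sumTo (suc m) (λ i → A i ℤ.* - inv1+t (m ∸ i)) ℤ.+ A (suc m) ℤ.* + 1
      ≡⟨ cong (ℤ._+ A (suc m) ℤ.* + 1) (trans (sumTo-cong (suc m) (λ {i} _ → sym (ℤ.neg-distribʳ-* (A i) _)))
                                              (sumTo-neg (suc m) _)) ⟩
    - B m ℤ.+ A (suc m) ℤ.* + 1
      ≡⟨ rearrange (B m) (A (suc m)) ⟩
    A (suc m) - B m
      ∎
    where
    open ≡-Reasoning
    rearrange : ∀ b a → - b ℤ.+ a ℤ.* + 1 ≡ a - b
    rearrange = solve-∀

  E-factor : BSeries
  E-factor = ((lift one ⊕ᵇ lift tS) ⊖ᵇ (uS ⊛ᵇ lift tS)) ⊖ᵇ ((lift tS ⊛ᵇ (lift one ⊖ᵇ uS)) ⊛ᵇ lift B)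

  E-rhs-coeff : ∀ n k → E-rhs n k ≡ sumTo (suc n) (λ i → E-factor i k ℤ.* A (n ∸ i))
  E-rhs-coeff = ⊛ᵇ-lift E-factor A

  t[1-u]B : ∀ i k → ((lift tS ⊛ᵇ (lift one ⊖ᵇ uS)) ⊛ᵇ lift B) i k
                    ≡ shift (λ i′ → (lift one ⊖ᵇ uS) 0 k ℤ.* B i′) i
  t[1-u]B i k = begin
    ((lift tS ⊛ᵇ H) ⊛ᵇ lift B) i k               ≡⟨ ⊛ᵇ-lift (lift tS ⊛ᵇ H) B i k ⟩
    sumTo (suc i) (λ i′ → (lift tS ⊛ᵇ H) i′ k ℤ.* B (i ∸ i′))
      ≡⟨ sumTo-cong (suc i) (λ {i′} _ → cong (ℤ._* B (i ∸ i′)) (lift-tS-⊛ᵇ H i′ k)) ⟩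
    (shift (λ r → H r k) ⊛ B) i                  ≡⟨ shift-⊛ (λ r → H r k) B i ⟩
    shift ((λ r → H r k) ⊛ B) i
      ≡⟨ shift-cong i (λ i′ → ⊛-constantˡ (λ r → H r k) B i′ (H-vanishes k)) ⟩
    shift (λ i′ → H 0 k ℤ.* B i′) i              ∎
    where
    open ≡-Reasoning
    H = lift one ⊖ᵇ uS
    H-vanishes : ∀ k r → H (suc r) k ≡ + 0
    H-vanishes zero    r = refl
    H-vanishes (suc k) r = refl
    shift-cong : ∀ i {f g : Series} → (∀ i′ → f i′ ≡ g i′) → shift f i ≡ shift g i
    shift-cong zero    _   = refl
    shift-cong (suc i) f≡g = f≡g i

  E-factor-expand : ∀ i k → E-factor i k ≡ ((lift one i k ℤ.+ lift tS i k) - shift (lift tS i) k)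
                             - shift (λ i′ → (lift one ⊖ᵇ uS) 0 k ℤ.* B i′) i
  E-factor-expand i k =
    cong₂ (λ a b → ((lift one i k ℤ.+ lift tS i k) - a) - b) (uS-⊛ᵇ (lift tS) i k) (t[1-u]B i k)

  E-factor-0 : ∀ i → E-factor i 0 ≡ (one i ℤ.+ tS i) - shift B i
  E-factor-0 zero    = E-factor-expand 0 0
  E-factor-0 (suc i) = trans (E-factor-expand (suc i) 0) (simplify (one (suc i) ℤ.+ tS (suc i)) (B i))
    where
    simplify : ∀ a b → (a - + 0) - + 1 ℤ.* b ≡ a - b
    simplify = solve-∀

  E-factor-1 : ∀ i → E-factor i 1 ≡ shift B i - tS i
  E-factor-1 zero    = E-factor-expand 0 1
  E-factor-1 (suc i) = trans (E-factor-expand (suc i) 1) (simplify (tS (suc i)) (B i))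
    where
    simplify : ∀ a b → ((+ 0 ℤ.+ + 0) - a) - (+ 0 - + 1) ℤ.* b ≡ b - a
    simplify = solve-∀

  E-factor-≥2 : ∀ i k → E-factor i (suc (suc k)) ≡ + 0
  E-factor-≥2 zero    k = E-factor-expand 0 (suc (suc k))
  E-factor-≥2 (suc i) k = E-factor-expand (suc i) (suc (suc k))

  E-rhs-≥2 : ∀ n k → E-rhs n (suc (suc k)) ≡ + 0
  E-rhs-≥2 n k = trans (E-rhs-coeff n (suc (suc k)))
                       (sumTo-zero (suc n) λ {i} _ → cong (ℤ._* A (n ∸ i)) (E-factor-≥2 i k))

  E-rhs-0+1 : ∀ n → E-rhs n 0 ℤ.+ E-rhs n 1 ≡ A n
  E-rhs-0+1 n = begin
    E-rhs n 0 ℤ.+ E-rhs n 1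
      ≡⟨ cong₂ ℤ._+_ (E-rhs-coeff n 0) (E-rhs-coeff n 1) ⟩
    sumTo (suc n) (λ i → E-factor i 0 ℤ.* A (n ∸ i)) ℤ.+ sumTo (suc n) (λ i → E-factor i 1 ℤ.* A (n ∸ i))
      ≡⟨ sumTo-+ (suc n) _ _ ⟨
    sumTo (suc n) (λ i → E-factor i 0 ℤ.* A (n ∸ i) ℤ.+ E-factor i 1 ℤ.* A (n ∸ i))
      ≡⟨ sumTo-cong (suc n) (λ {i} _ → E-factor-0+1 i (A (n ∸ i))) ⟩
    sumTo (suc n) (λ i → one i ℤ.* A (n ∸ i))
      ≡⟨ sumTo-only-first n (λ _ → refl) ⟩
    + 1 ℤ.* A n
      ≡⟨ ℤ.*-identityˡ (A n) ⟩
    A n ∎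
    where
    open ≡-Reasoning
    E-factor-0+1 : ∀ i a → E-factor i 0 ℤ.* a ℤ.+ E-factor i 1 ℤ.* a ≡ one i ℤ.* a
    E-factor-0+1 i a rewrite E-factor-0 i | E-factor-1 i = telescope (one i) (tS i) (shift B i) a
      where
      telescope : ∀ o t d a → ((o ℤ.+ t) - d) ℤ.* a ℤ.+ (d - t) ℤ.* a ≡ o ℤ.* a
      telescope = solve-∀

  P-rhs≡E-rhs-0 : ∀ n → P-rhs n ≡ E-rhs n 0
  P-rhs≡E-rhs-0 n = sym (trans (E-rhs-coeff n 0) (sumTo-cong (suc n) λ {i} _ →
    cong (ℤ._* A (n ∸ i)) (trans (E-factor-0 i) (cong (λ d → (one i ℤ.+ tS i) - d) (sym (tS-⊛ B i))))))

  E-rhs-1-suc : ∀ n → E-rhs (suc n) 1 ≡ sumTo n (λ j → B (suc j) ℤ.* A (n ∸ suc j))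
  E-rhs-1-suc n = begin
    E-rhs (suc n) 1
      ≡⟨ E-rhs-coeff (suc n) 1 ⟩
    sumTo (suc (suc n)) (λ i → E-factor i 1 ℤ.* A (suc n ∸ i))
      ≡⟨ sumTo-unfoldˡ (suc n) _ ⟩
    E-factor 0 1 ℤ.* A (suc n) ℤ.+ sumTo (suc n) (λ i → E-factor (suc i) 1 ℤ.* A (n ∸ i))
      ≡⟨ cong₂ ℤ._+_ (cong (ℤ._* A (suc n)) (E-factor-1 0)) (sumTo-unfoldˡ n _) ⟩
    + 0 ℤ.+ (E-factor 1 1 ℤ.* A n ℤ.+ sumTo n (λ j → E-factor (suc (suc j)) 1 ℤ.* A (n ∸ suc j)))
      ≡⟨ ℤ.+-identityˡ _ ⟩
    E-factor 1 1 ℤ.* A n ℤ.+ sumTo n (λ j → E-factor (suc (suc j)) 1 ℤ.* A (n ∸ suc j))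
      ≡⟨ cong₂ ℤ._+_ (cong (ℤ._* A n) (E-factor-1 1))
                     (sumTo-cong n λ {j} _ → cong (ℤ._* A (n ∸ suc j))
                                                  (trans (E-factor-1 (suc (suc j))) (ℤ.+-identityʳ (B (suc j))))) ⟩
    + 0 ℤ.+ sumTo n (λ j → B (suc j) ℤ.* A (n ∸ suc j))
      ≡⟨ ℤ.+-identityˡ _ ⟩
    sumTo n (λ j → B (suc j) ℤ.* A (n ∸ suc j)) ∎
    where open ≡-Reasoning

  +-difference : ∀ {m n o} → m + n ≡ o → + n ≡ + o - + m
  +-difference {m} {n} refl = trans (cancel (+ m) (+ n)) (cong (_- + m) (sym (ℤ.pos-+ m n)))
    where
    cancel : ∀ a b → b ≡ (a ℤ.+ b) - a
    cancel = solve-∀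

  recurrence⇒B : ∀ (c : ℕ → ℕ) → c 0 ≡ 1 → (∀ k → c k + c (suc k) ≡ length (K (suc k))) → ∀ k → + c k ≡ B k
  recurrence⇒B c c₀ step zero    = cong +_ c₀
  recurrence⇒B c c₀ step (suc k) = begin
    + c (suc k)     ≡⟨ +-difference (step k) ⟩
    A (suc k) - + c k ≡⟨ cong (λ b → A (suc k) - b) (recurrence⇒B c c₀ step k) ⟩
    A (suc k) - B k ≡⟨ B-suc k ⟨
    B (suc k)       ∎
    where open ≡-Reasoning

  +length-K-headNot : ∀ k → + length (K-headNot k k) ≡ B k
  +length-K-headNot = recurrence⇒B (λ k → length (K-headNot k k)) refl length-K-headNot-recurrence

  +length-K-lastNot : ∀ k → + length (K-lastNot k k) ≡ B k
  +length-K-lastNot = recurrence⇒B (λ k → length (K-lastNot k k)) refl length-K-lastNot-recurrence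

  +length-concatMap-upTo : ∀ {C : Set} n (f : ℕ → List C) →
                           + length (concatMap f (upTo n)) ≡ sumTo n (λ k → + length (f k))
  +length-concatMap-upTo zero    f = refl
  +length-concatMap-upTo (suc n) f = begin
    + length (concatMap f (upTo (suc n)))
      ≡⟨ cong (λ ks → + length (concatMap f ks)) (upTo-∷ʳ n) ⟨
    + length (concatMap f (upTo n ∷ʳ n))
      ≡⟨ cong (+_ ∘ length) (concatMap-++ f (upTo n) (n ∷ [])) ⟩
    + length (concatMap f (upTo n) ++ (f n ++ []))         ≡⟨ cong +_ (length-++ (concatMap f (upTo n))) ⟩
    + (length (concatMap f (upTo n)) + length (f n ++ [])) ≡⟨ ℤ.pos-+ (length (concatMap f (upTo n))) _ ⟩
    + length (concatMap f (upTo n)) ℤ.+ + length (f n ++ [])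
      ≡⟨ cong₂ ℤ._+_ (+length-concatMap-upTo n f) (cong (+_ ∘ length) (++-identityʳ (f n))) ⟩
    sumTo n (λ k → + length (f k)) ℤ.+ + length (f n)      ∎
    where open ≡-Reasoning

  E-1-suc : ∀ n → E (suc n) 1 ≡ sumTo n (λ k → + length (K-lastNot n (n ∸ k)) ℤ.* + length (K-headNot k k))
  E-1-suc n = begin
    + length (K-p≡1 (suc n))   ≡⟨ cong +_ (length-K-p≡1 n) ⟩
    + length (splits n)        ≡⟨ +length-concatMap-upTo n _ ⟩
    sumTo n (λ k → + length (cartesianProduct (K-lastNot n (n ∸ k)) (K-headNot k k)))
      ≡⟨ sumTo-cong n (λ {k} _ → trans (cong +_ (length-cartesianProduct (K-lastNot n (n ∸ k)) (K-headNot k k)))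
                                       (ℤ.pos-* (length (K-lastNot n (n ∸ k))) _)) ⟩
    sumTo n (λ k → + length (K-lastNot n (n ∸ k)) ℤ.* + length (K-headNot k k)) ∎
    where open ≡-Reasoning

  -- The term β = [] of the decomposition, B (m + 1), is the term B (m + 1) · A 0 of the series,
  -- whence the rotation.
  E-1 : ∀ n → E n 1 ≡ E-rhs n 1
  E-1 zero          = refl
  E-1 (suc zero)    = trans (E-1-suc 0) (sym (E-rhs-1-suc 0))
  E-1 (suc (suc m)) = trans (E-1-suc (suc m)) (trans (sumTo-rotate m first rest) (sym (E-rhs-1-suc (suc m))))
    where
    first : + length (K-lastNot (suc m) (suc m)) ℤ.* + 1 ≡ B (suc m) ℤ.* A (m ∸ m)
    first = cong₂ ℤ._*_ (+length-K-lastNot (suc m)) (cong A (sym (n∸n≡0 m)))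
    rest : ∀ {k} → k < m → + length (K-lastNot (suc m) (m ∸ k)) ℤ.* + length (K-headNot (suc k) (suc k))
                           ≡ B (suc k) ℤ.* A (m ∸ k)
    rest {k} _ = trans (cong₂ ℤ._*_ (cong +_ (length-K-lastNot-< (s≤s (m∸n≤m m k)))) (+length-K-headNot (suc k)))
                       (ℤ.*-comm (A (m ∸ k)) (B (suc k)))

  +-moveʳ : ∀ {x y a} → x ℤ.+ y ≡ a → x ≡ a - y
  +-moveʳ {x} {y} refl = cancel x y
    where
    cancel : ∀ x y → x ≡ (x ℤ.+ y) - y
    cancel = solve-∀

  E-0≡A-E-1 : ∀ n → E n 0 ≡ A n - E n 1
  E-0≡A-E-1 n = +-moveʳ {y = E n 1}
    (trans (sym (ℤ.pos-+ (length (filterᵇ (λ σ → p σ ≡ᵇ 0) (K n))) _)) (cong +_ (length-K-p≡0+p≡1 n)))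

  E-≥2 : ∀ n k → E n (suc (suc k)) ≡ + 0
  E-≥2 n k = cong (+_ ∘ length) (K-p≥2≡[] n k)

  E≡E-rhs : ∀ n k → E n k ≡ E-rhs n k
  E≡E-rhs n zero          =
    trans (E-0≡A-E-1 n) (trans (cong (λ e → A n - e) (E-1 n)) (sym (+-moveʳ (E-rhs-0+1 n))))
  E≡E-rhs n (suc zero)    = E-1 n
  E≡E-rhs n (suc (suc k)) = trans (E-≥2 n k) (sym (E-rhs-≥2 n k))

  P≡P-rhs : ∀ n → P n ≡ P-rhs n
  P≡P-rhs n = trans (E≡E-rhs n 0) (sym (P-rhs≡E-rhs-0 n))

  E≡E-init-from-1 : ∀ n → E n 1 ≡ E-init n 1 → A n - E-init n 1 ≡ E-init n 0 →
                    (∀ k → E-init n (suc (suc k)) ≡ + 0) → ∀ k → E n k ≡ E-init n k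
  E≡E-init-from-1 n e₁ e₀ vanish zero          = trans (E-0≡A-E-1 n) (trans (cong (λ e → A n - e) e₁) e₀)
  E≡E-init-from-1 n e₁ e₀ vanish (suc zero)    = e₁
  E≡E-init-from-1 n e₁ e₀ vanish (suc (suc k)) = trans (E-≥2 n k) (sym (vanish k))

  -- Only the u-coefficients are evaluated; the constant ones follow from A, which is far cheaper to
  -- evaluate than p.
  initial-terms : ∀ n k → n ≤ 8 → E n k ≡ E-init n k
  initial-terms 0 k _ = E≡E-init-from-1 0 refl refl (λ _ → refl) k
  initial-terms 1 k _ = E≡E-init-from-1 1 refl refl (λ _ → refl) k
  initial-terms 2 k _ = E≡E-init-from-1 2 refl refl (λ _ → refl) k
  initial-terms 3 k _ = E≡E-init-from-1 3 refl refl (λ _ → refl) k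
  initial-terms 4 k _ = E≡E-init-from-1 4 refl refl (λ _ → refl) k
  initial-terms 5 k _ = E≡E-init-from-1 5 refl refl (λ _ → refl) k
  initial-terms 6 k _ = E≡E-init-from-1 6 refl refl (λ _ → refl) k
  initial-terms 7 k _ = E≡E-init-from-1 7 refl refl (λ _ → refl) k
  initial-terms 8 k _ = E≡E-init-from-1 8 refl refl (λ _ → refl) k
  initial-terms (suc (suc (suc (suc (suc (suc (suc (suc (suc _))))))))) _
    (s≤s (s≤s (s≤s (s≤s (s≤s (s≤s (s≤s (s≤s ()))))))))

theorem3p5 : ((n : ℕ) → P n ≡ P-rhs n)
    × ((n k : ℕ) → E n k ≡ E-rhs n k)
    × ((n k : ℕ) → n ≤ 8 → E n k ≡ E-init n k)
theorem3p5 = P≡P-rhs , E≡E-rhs , initial-terms
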